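{- Let $R$ be a Dedekind domain and let $P$, $Q$, $M$ be nonzero ideals of $R$ such that $P$ and $Q$ are prime, $M\not\subseteq Q$, $R/P$ and $R/M$ are finite and nontrivial, and $|R/Q|=2$. Let $\alpha$ be a positive integer. Then \[s'(G_{R/P^{\alpha}})=\tfrac12|R/P|^{\alpha}\varphi(R/P^{\alpha})=\tfrac12|R/P|^{2\alpha-1}(|R/P|-1)\] and \[s'(G_{R/QM})\le\tfrac12|R/M|\,\varphi(R/M).\]
   Context: For an ideal $I$ with $R/I$ finite, $G_{R/I}$ is the unitary Cayley graph of $R/I$: vertex set $R/I$, with $a+I$, $b+I$ adjacent iff $a-b+I$ is a unit of $R/I$; $\varphi(R/I)$ is the number of units of $R/I$. An edge coloring is strong if any two distinct edges having adjacent endpoints receive different colors; the strong chromatic index $s'(G)$ is the least number of colors in a strong edge coloring of $G$. -}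

module Defs where

open import Level using (Level; _⊔_; suc)
open import Algebra.Bundles using (CommutativeRing)
open import Data.Nat using (ℕ; zero; _≤_; _∸_) renaming (suc to sucℕ)
open import Data.Fin using (Fin; toℕ) renaming (zero to fzero; suc to fsuc)
open import Data.Product using (Σ; ∃; _×_; _,_; proj₁; proj₂)
open import Data.Sum using (_⊎_)
open import Data.List using (List; foldr; map)
open import Data.List.Relation.Unary.All using (All)
open import Relation.Nullary using (¬_)
open import Relation.Binary.PropositionalEquality using (_≡_; _≢_)

module _ {c ℓ : Level} (R : CommutativeRing c ℓ) where
  open CommutativeRing R

  RPred : Set (suc (c ⊔ ℓ))
  RPred = Carrier → Set (c ⊔ ℓ)

  _⊆ₚ_ : RPred → RPred → Set (c ⊔ ℓ)
  I ⊆ₚ J = ∀ x → I x → J x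

  record Ideal : Set (suc (c ⊔ ℓ)) where
    field
      mem    : RPred
      resp   : ∀ {x y} → x ≈ y → mem x → mem y
      has0   : mem 0#
      closed+ : ∀ {x y} → mem x → mem y → mem (x + y)
      absorb : ∀ r {x} → mem x → mem (r * x)
  open Ideal public

  _⊆_ : Ideal → Ideal → Set (c ⊔ ℓ)
  I ⊆ J = mem I ⊆ₚ mem J

  NonZeroIdeal : Ideal → Set (c ⊔ ℓ)
  NonZeroIdeal I = Σ Carrier λ x → mem I x × ¬ (x ≈ 0#)

  IsPrimeIdeal : Ideal → Set (c ⊔ ℓ)
  IsPrimeIdeal P = ¬ mem P 1# × (∀ a b → mem P (a * b) → mem P a ⊎ mem P b)

  IsMaximalIdeal : Ideal → Set (suc (c ⊔ ℓ))
  IsMaximalIdeal P = ¬ mem P 1# × (∀ J → P ⊆ J → J ⊆ P ⊎ mem J 1#)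

  sumL : List Carrier → Carrier
  sumL = foldr _+_ 0#

  _·ₚ_ : RPred → RPred → RPred
  (I ·ₚ J) x = Σ (List (Carrier × Carrier)) λ l →
                 All (λ ab → I (proj₁ ab) × J (proj₂ ab)) l ×
                 (x ≈ sumL (map (λ ab → proj₁ ab * proj₂ ab) l))

  wholeₚ : RPred
  wholeₚ _ = Level.Lift (c ⊔ ℓ) Data.Unit.⊤
    where import Data.Unit

  _^ₚ_ : RPred → ℕ → RPred
  I ^ₚ zero = wholeₚ
  I ^ₚ sucℕ n = I ·ₚ (I ^ₚ n)

  pow : Carrier → ℕ → Carrier
  pow a zero = 1#
  pow a (sucℕ n) = a * pow a n

  sumFin : (n : ℕ) → (Fin n → Carrier) → Carrier
  sumFin zero f = 0#
  sumFin (sucℕ n) f = f fzero + sumFin n (λ i → f (fsuc i))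

  IsIntegralDomain : Set (c ⊔ ℓ)
  IsIntegralDomain = ¬ (1# ≈ 0#) × (∀ a b → a * b ≈ 0# → a ≈ 0# ⊎ b ≈ 0#)

  IsNoetherian : Set (suc (c ⊔ ℓ))
  IsNoetherian = (I : ℕ → Ideal) → (∀ n → I n ⊆ I (sucℕ n)) →
                 Σ ℕ λ N → ∀ n → N ≤ n → I n ⊆ I N

  -- a/b (b ≠ 0) integral over R, i.e. a^n + Σ_{i<n} c_i a^i b^(n-i) = 0,
  -- implies a/b ∈ R, i.e. b ∣ a.
  IsIntegrallyClosed : Set (c ⊔ ℓ)
  IsIntegrallyClosed = ∀ a b → ¬ (b ≈ 0#) →
    (Σ ℕ λ n → Σ (Fin n → Carrier) λ cs →
       pow a n + sumFin n (λ i → cs i * (pow a (toℕ i) * pow b (n ∸ toℕ i))) ≈ 0#) →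
    Σ Carrier λ r → a ≈ r * b

  DimAtMostOne : Set (suc (c ⊔ ℓ))
  DimAtMostOne = ∀ P → IsPrimeIdeal P → NonZeroIdeal P → IsMaximalIdeal P

  record IsDedekindDomain : Set (suc (c ⊔ ℓ)) where
    field
      domain     : IsIntegralDomain
      noetherian : IsNoetherian
      intClosed  : IsIntegrallyClosed
      dimLe1     : DimAtMostOne

  Cong : RPred → Carrier → Carrier → Set (c ⊔ ℓ)
  Cong I x y = I (x - y)

  -- |R/I| = n : an enumeration Fin n → R of a complete irredundant
  -- system of representatives of R/I.
  QuotCard : RPred → ℕ → Set (c ⊔ ℓ)
  QuotCard I n = Σ (Fin n → Carrier) λ f →
    (∀ i j → Cong I (f i) (f j) → i ≡ j) × (∀ x → Σ (Fin n) λ i → Cong I x (f i))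

  IsUnitMod : RPred → Carrier → Set (c ⊔ ℓ)
  IsUnitMod I x = Σ Carrier λ y → Cong I (x * y) 1#

  -- φ(R/I) = k : an enumeration of the units of R/I
  UnitCount : RPred → ℕ → Set (c ⊔ ℓ)
  UnitCount I k = Σ (Fin k → Carrier) λ g →
    (∀ i → IsUnitMod I (g i)) ×
    (∀ i j → Cong I (g i) (g j) → i ≡ j) ×
    (∀ x → IsUnitMod I x → Σ (Fin k) λ i → Cong I x (g i))

  -- adjacency in the unitary Cayley graph G_{R/I} (on representatives)
  Adj : RPred → Carrier → Carrier → Set (c ⊔ ℓ)
  Adj I x y = IsUnitMod I (x - y)

  SameEdge : RPred → Carrier → Carrier → Carrier → Carrier → Set (c ⊔ ℓ)
  SameEdge I x y u v = (Cong I x u × Cong I y v) ⊎ (Cong I x v × Cong I y u)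

  -- a strong edge coloring of G_{R/I} with k colors: a color for each
  -- (unordered) pair of vertices of R/I, such that two distinct edges
  -- with an endpoint of one adjacent to an endpoint of the other get
  -- different colors.
  StrongEdgeColoring : RPred → ℕ → Set (c ⊔ ℓ)
  StrongEdgeColoring I k = Σ (Carrier → Carrier → Fin k) λ col →
    (∀ x x' y y' → Cong I x x' → Cong I y y' → col x y ≡ col x' y') ×
    (∀ x y → col x y ≡ col y x) ×
    (∀ x y u v → Adj I x y → Adj I u v → ¬ SameEdge I x y u v →
       (Adj I x u ⊎ Adj I x v ⊎ Adj I y u ⊎ Adj I y v) →
       col x y ≢ col u v)

  IsStrongChromaticIndex : RPred → ℕ → Set (c ⊔ ℓ)
  IsStrongChromaticIndex I s =
    StrongEdgeColoring I s × (∀ t → StrongEdgeColoring I t → s ≤ t)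

module Submission where

-- The Dedekind hypothesis makes the argument classical: a maximal ideal P decides
-- every proposition A, through the ideal P + {x | A}. A nonzero prime P is locally
-- principal, s P ⊆ (π) with s ∉ P, so the residues mod Pᵅ are the π-adic expansions
-- with digits from R/P: |R/Pᵅ| = pᵅ, and the units are the expansions with a nonzero
-- leading digit, φ(R/Pᵅ) = (p - 1) pᵅ⁻¹. Colouring every edge of a unitary Cayley
-- graph G_{R/J} by itself is a strong colouring with |R/J| φ(R/J) / 2 colours. In
-- G_{R/Pᵅ}, complete multipartite over the classes mod P, any two edges are joined
-- by an edge, so no strong colouring can do with fewer. For Q M, the colouring of
-- G_{R/M} pulled back to R/QM stays strong: Q and M are comaximal, and since
-- |R/Q| = 2 two edges lying over the same edge of G_{R/M} are not joined.

open import Level using (Level; _⊔_; lift)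
open import Algebra.Bundles using (CommutativeRing)
import Algebra.Solver.Ring.AlmostCommutativeRing as ACR
open import Axiom.ExcludedMiddle using (ExcludedMiddle)
open import Axiom.DoubleNegationElimination using (DoubleNegationElimination; em⇒dne)
open import Data.Bool using (Bool; true; false; not; T)
open import Data.Bool.Properties using (T-irrelevant)
open import Data.Empty using (⊥; ⊥-elim)
open import Data.Fin as Fin using (Fin; toℕ; inject₁; fromℕ; remQuot; combine; punchIn; punchOut)
  renaming (zero to fzero; suc to fsuc)
import Data.Fin.Properties as Fin
open import Data.Integer as ℤ using (ℤ; +_; -[1+_]; _⊖_; sign; ∣_∣; _◃_)
import Data.Integer.Properties as ℤ
open import Data.List using (List; []; _∷_; _++_; map)
open import Data.List.Relation.Unary.All using (All; []; _∷_)
open import Data.List.Relation.Unary.All.Properties using (++⁺)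
open import Data.Maybe using (Maybe; just; nothing)
open import Data.Nat as ℕ using (ℕ; zero; suc; _≤_; _<_; s≤s; _∸_; _^_; _<ᵇ_)
import Data.Nat.Properties as ℕ
open import Data.Nat.Induction using (<-rec)
open import Data.Product using (Σ; _×_; _,_; proj₁; proj₂)
open import Data.Sign as Sign using (Sign)
open import Data.Sum using (_⊎_; inj₁; inj₂; [_,_]′)
open import Data.Unit using (tt)
open import Function using (_∘_)
open import Relation.Nullary using (¬_; Dec; yes; no)
open import Relation.Nullary.Decidable using (⌊_⌋; toWitness; fromWitness)
import Relation.Binary.PropositionalEquality as ≡
open import Defs

-- The ring solver needs a coefficient ring with decidable equality, so R is
-- solved over ℤ through the canonical homomorphism ℤ → R.
module IntegerCoefficients {c ℓ : Level} (R : CommutativeRing c ℓ) where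

  open CommutativeRing R
  open import Relation.Binary.Reasoning.Setoid setoid
  open import Algebra.Properties.Ring ring using (-‿involutive; -‿distribˡ-*; -0#≈0#; -‿+-comm)
  open import Algebra.Properties.Semiring.Mult.TCOptimised semiring using (1+×; ×-homo-+; ×1-homo-*) renaming (_×_ to _×′_)

  ⟦_⟧ℤ : ℤ → Carrier
  ⟦ + n ⟧ℤ = n ×′ 1#
  ⟦ -[1+ n ] ⟧ℤ = - (suc n ×′ 1#)

  private
    1+m-1+n≈m-n : ∀ m n → (1# + m) - (1# + n) ≈ m - n
    1+m-1+n≈m-n m n = begin
      (1# + m) + - (1# + n)     ≈⟨ +-congˡ (-‿+-comm 1# n) ⟨
      (1# + m) + (- 1# + - n)   ≈⟨ +-congʳ (+-comm 1# m) ⟩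
      (m + 1#) + (- 1# + - n)   ≈⟨ +-assoc m 1# _ ⟩
      m + (1# + (- 1# + - n))   ≈⟨ +-congˡ (+-assoc 1# (- 1#) (- n)) ⟨
      m + ((1# + - 1#) + - n)   ≈⟨ +-congˡ (+-congʳ (-‿inverseʳ 1#)) ⟩
      m + (0# + - n)            ≈⟨ +-congˡ (+-identityˡ (- n)) ⟩
      m - n                     ∎

    m-0≈m : ∀ m → m ≈ m - 0#
    m-0≈m m = sym (trans (+-congˡ -0#≈0#) (+-identityʳ m))

  ⟦⊖⟧ : ∀ m n → ⟦ m ⊖ n ⟧ℤ ≈ m ×′ 1# - n ×′ 1#
  ⟦⊖⟧ zero zero = m-0≈m 0#
  ⟦⊖⟧ (suc m) zero = m-0≈m (suc m ×′ 1#)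
  ⟦⊖⟧ zero (suc n) = sym (+-identityˡ _)
  ⟦⊖⟧ (suc m) (suc n) = begin
    ⟦ suc m ⊖ suc n ⟧ℤ                   ≡⟨ ≡.cong ⟦_⟧ℤ (ℤ.[1+m]⊖[1+n]≡m⊖n m n) ⟩
    ⟦ m ⊖ n ⟧ℤ                           ≈⟨ ⟦⊖⟧ m n ⟩
    m ×′ 1# - n ×′ 1#                    ≈⟨ 1+m-1+n≈m-n (m ×′ 1#) (n ×′ 1#) ⟨
    (1# + m ×′ 1#) - (1# + n ×′ 1#)      ≈⟨ +-cong (1+× m 1#) (-‿cong (1+× n 1#)) ⟨
    suc m ×′ 1# - suc n ×′ 1#            ∎

  ⟦+⟧ : ∀ i j → ⟦ i ℤ.+ j ⟧ℤ ≈ ⟦ i ⟧ℤ + ⟦ j ⟧ℤ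
  ⟦+⟧ -[1+ m ] -[1+ n ] = trans (-‿cong (begin
    suc (suc (m ℕ.+ n)) ×′ 1#          ≈⟨ 1+× (suc (m ℕ.+ n)) 1# ⟩
    1# + (suc m ℕ.+ n) ×′ 1#           ≈⟨ +-congˡ (×-homo-+ 1# (suc m) n) ⟩
    1# + (suc m ×′ 1# + n ×′ 1#)       ≈⟨ +-assoc 1# _ _ ⟨
    (1# + suc m ×′ 1#) + n ×′ 1#       ≈⟨ +-congʳ (+-comm 1# _) ⟩
    (suc m ×′ 1# + 1#) + n ×′ 1#       ≈⟨ +-assoc _ 1# _ ⟩
    suc m ×′ 1# + (1# + n ×′ 1#)       ≈⟨ +-congˡ (1+× n 1#) ⟨
    suc m ×′ 1# + suc n ×′ 1#          ∎)) (sym (-‿+-comm _ _))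
  ⟦+⟧ -[1+ m ] (+ n) = trans (⟦⊖⟧ n (suc m)) (+-comm _ _)
  ⟦+⟧ (+ m) -[1+ n ] = ⟦⊖⟧ m (suc n)
  ⟦+⟧ (+ m) (+ n) = ×-homo-+ 1# m n

  private
    ⟦_⟧ₛ : Sign → Carrier
    ⟦ Sign.+ ⟧ₛ = 1#
    ⟦ Sign.- ⟧ₛ = - 1#

    ⟦◃⟧ : ∀ s n → ⟦ s ◃ n ⟧ℤ ≈ ⟦ s ⟧ₛ * (n ×′ 1#)
    ⟦◃⟧ s zero = sym (zeroʳ _)
    ⟦◃⟧ Sign.- (suc n) = trans (-‿cong (sym (*-identityˡ _))) (-‿distribˡ-* _ _)
    ⟦◃⟧ Sign.+ (suc n) = sym (*-identityˡ _)

    ⟦sign◃∣∣⟧ : ∀ i → ⟦ i ⟧ℤ ≈ ⟦ sign i ⟧ₛ * (∣ i ∣ ×′ 1#)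
    ⟦sign◃∣∣⟧ i = trans (reflexive (≡.cong ⟦_⟧ℤ (≡.sym (ℤ.signᵢ◃∣i∣≡i i)))) (⟦◃⟧ (sign i) ∣ i ∣)

    ⟦*⟧ₛ : ∀ s t → ⟦ s Sign.* t ⟧ₛ ≈ ⟦ s ⟧ₛ * ⟦ t ⟧ₛ
    ⟦*⟧ₛ Sign.- Sign.- = sym (trans (sym (-‿distribˡ-* _ _)) (trans (-‿cong (*-identityˡ _)) (-‿involutive _)))
    ⟦*⟧ₛ Sign.- Sign.+ = sym (*-identityʳ _)
    ⟦*⟧ₛ Sign.+ Sign.- = sym (*-identityˡ _)
    ⟦*⟧ₛ Sign.+ Sign.+ = sym (*-identityˡ _)

    *-interchange : ∀ a b x y → (a * b) * (x * y) ≈ (a * x) * (b * y)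
    *-interchange a b x y = begin
      (a * b) * (x * y) ≈⟨ *-assoc a b _ ⟩
      a * (b * (x * y)) ≈⟨ *-congˡ (*-assoc b x y) ⟨
      a * ((b * x) * y) ≈⟨ *-congˡ (*-congʳ (*-comm b x)) ⟩
      a * ((x * b) * y) ≈⟨ *-congˡ (*-assoc x b y) ⟩
      a * (x * (b * y)) ≈⟨ *-assoc a x _ ⟨
      (a * x) * (b * y) ∎

  ⟦*⟧ : ∀ i j → ⟦ i ℤ.* j ⟧ℤ ≈ ⟦ i ⟧ℤ * ⟦ j ⟧ℤ
  ⟦*⟧ i j = begin
    ⟦ sign i Sign.* sign j ◃ ∣ i ∣ ℕ.* ∣ j ∣ ⟧ℤ               ≈⟨ ⟦◃⟧ (sign i Sign.* sign j) (∣ i ∣ ℕ.* ∣ j ∣) ⟩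
    ⟦ sign i Sign.* sign j ⟧ₛ * ((∣ i ∣ ℕ.* ∣ j ∣) ×′ 1#)       ≈⟨ *-cong (⟦*⟧ₛ (sign i) (sign j)) (×1-homo-* ∣ i ∣ ∣ j ∣) ⟩
    (⟦ sign i ⟧ₛ * ⟦ sign j ⟧ₛ) * ((∣ i ∣ ×′ 1#) * (∣ j ∣ ×′ 1#)) ≈⟨ *-interchange _ _ _ _ ⟩
    (⟦ sign i ⟧ₛ * (∣ i ∣ ×′ 1#)) * (⟦ sign j ⟧ₛ * (∣ j ∣ ×′ 1#)) ≈⟨ *-cong (⟦sign◃∣∣⟧ i) (⟦sign◃∣∣⟧ j) ⟨
    ⟦ i ⟧ℤ * ⟦ j ⟧ℤ                                           ∎

  ⟦-⟧ : ∀ i → ⟦ ℤ.- i ⟧ℤ ≈ - ⟦ i ⟧ℤ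
  ⟦-⟧ -[1+ n ] = sym (-‿involutive _)
  ⟦-⟧ (+ zero) = sym -0#≈0#
  ⟦-⟧ (+ suc n) = refl

  private
    almostCommutativeRing : ACR.AlmostCommutativeRing c ℓ
    almostCommutativeRing = ACR.fromCommutativeRing R

    ⟦⟧ℤ-homomorphism : ℤ.+-*-rawRing ACR.-Raw-AlmostCommutative⟶ almostCommutativeRing
    ⟦⟧ℤ-homomorphism = record
      { ⟦_⟧ = ⟦_⟧ℤ ; +-homo = ⟦+⟧ ; *-homo = ⟦*⟧ ; -‿homo = ⟦-⟧
      ; 0-homo = refl ; 1-homo = refl }

    ⟦⟧ℤ-≟ : ∀ i j → Maybe (⟦ i ⟧ℤ ≈ ⟦ j ⟧ℤ)
    ⟦⟧ℤ-≟ i j with i ℤ.≟ j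
    ... | yes ≡.refl = just refl
    ... | no _ = nothing

  open import Algebra.Solver.Ring ℤ.+-*-rawRing almostCommutativeRing ⟦⟧ℤ-homomorphism ⟦⟧ℤ-≟ public
    using (solve; _:+_; _:*_; :-_; _:-_; _:=_; con)

module Ideals {c ℓ : Level} (R : CommutativeRing c ℓ) where

  open CommutativeRing R
  open IntegerCoefficients R using (solve; _:+_; _:*_; :-_; _:-_; _:=_; con)

  record IsAdditiveSubmonoid (T : RPred R) : Set (c ⊔ ℓ) where
    field
      respects : ∀ {x y} → x ≈ y → T x → T y
      zero-mem : T 0#
      sum-mem  : ∀ {x y} → T x → T y → T (x + y)
  open IsAdditiveSubmonoid public

  ideal⇒additive : (J : Ideal R) → IsAdditiveSubmonoid (mem J)
  ideal⇒additive J = record { respects = resp J ; zero-mem = has0 J ; sum-mem = closed+ J }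

  module _ (J : Ideal R) where

    absorbʳ : ∀ {x} r → mem J x → mem J (x * r)
    absorbʳ r x∈J = resp J (*-comm r _) (absorb J r x∈J)

    closed-neg : ∀ {x} → mem J x → mem J (- x)
    closed-neg {x} x∈J = resp J (solve 1 (λ x → (:- con (+ 1)) :* x := :- x) refl x) (absorb J (- 1#) x∈J)

    closed-sub : ∀ {x y} → mem J x → mem J y → mem J (x - y)
    closed-sub x∈J y∈J = closed+ J x∈J (closed-neg y∈J)

    1∈⇒∈ : mem J 1# → ∀ x → mem J x
    1∈⇒∈ 1∈J x = resp J (*-identityˡ x) (absorbʳ x 1∈J)

    unit∈⇒1∈ : ∀ {x} → IsUnitMod R (mem J) x → mem J x → mem J 1#
    unit∈⇒1∈ {x} (y , xy≡1) x∈J =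
      resp J (solve 2 (λ x y → x :* y :- (x :* y :- con (+ 1)) := con (+ 1)) refl x y)
        (closed-sub (absorbʳ y x∈J) xy≡1)

    Cong-reflexive : ∀ {x y} → x ≈ y → Cong R (mem J) x y
    Cong-reflexive {x} {y} x≈y = resp J (trans (sym (-‿inverseʳ y)) (+-congʳ (sym x≈y))) (has0 J)

    Cong-sym : ∀ {x y} → Cong R (mem J) x y → Cong R (mem J) y x
    Cong-sym {x} {y} x≡y = resp J (solve 2 (λ x y → (:- con (+ 1)) :* (x :- y) := y :- x) refl x y) (absorb J (- 1#) x≡y)

    Cong-trans : ∀ {x y z} → Cong R (mem J) x y → Cong R (mem J) y z → Cong R (mem J) x z
    Cong-trans {x} {y} {z} x≡y y≡z = resp J (solve 3 (λ x y z → (x :- y) :+ (y :- z) := x :- z) refl x y z) (closed+ J x≡y y≡z)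

    Cong-sub : ∀ {x x′ y y′} → Cong R (mem J) x x′ → Cong R (mem J) y y′ → Cong R (mem J) (x - y) (x′ - y′)
    Cong-sub {x} {x′} {y} {y′} x≡x′ y≡y′ =
      resp J (solve 4 (λ x x′ y y′ → (x :- x′) :- (y :- y′) := (x :- y) :- (x′ :- y′)) refl x x′ y y′) (closed-sub x≡x′ y≡y′)

    Cong-mem : ∀ {x y} → Cong R (mem J) x y → mem J y → mem J x
    Cong-mem {x} {y} x≡y y∈J = resp J (solve 2 (λ x y → (x :- y) :+ y := x) refl x y) (closed+ J x≡y y∈J)

    IsUnitMod-resp : ∀ {x x′} → Cong R (mem J) x x′ → IsUnitMod R (mem J) x → IsUnitMod R (mem J) x′
    IsUnitMod-resp {x} {x′} x≡x′ (y , xy≡1) = y ,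
      resp J (solve 3 (λ x x′ y → (x :* y :- con (+ 1)) :- (x :- x′) :* y := x′ :* y :- con (+ 1)) refl x x′ y)
        (closed-sub xy≡1 (absorbʳ y x≡x′))

    Adj-resp : ∀ {x x′ y y′} → Cong R (mem J) x x′ → Cong R (mem J) y y′ → Adj R (mem J) x y → Adj R (mem J) x′ y′
    Adj-resp x≡x′ y≡y′ = IsUnitMod-resp (Cong-sub x≡x′ y≡y′)

    Adj-sym : ∀ {x y} → Adj R (mem J) x y → Adj R (mem J) y x
    Adj-sym {x} {y} (z , p) = - z ,
      resp J (solve 3 (λ x y z → (x :- y) :* z :- con (+ 1) := (y :- x) :* (:- z) :- con (+ 1)) refl x y z) p

    Cong⇒¬Adj : ¬ mem J 1# → ∀ {x y} → Cong R (mem J) x y → ¬ Adj R (mem J) x y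
    Cong⇒¬Adj 1∉J x≡y x~y = 1∉J (unit∈⇒1∈ x~y x≡y)

  IsUnitMod-mono : ∀ {I J} → _⊆ₚ_ R I J → ∀ {x} → IsUnitMod R I x → IsUnitMod R J x
  IsUnitMod-mono I⊆J {x} (y , xy≡1) = y , I⊆J (x * y - 1#) xy≡1

  private
    sumProducts : List (Carrier × Carrier) → Carrier
    sumProducts l = sumL R (map (λ ab → proj₁ ab * proj₂ ab) l)

    sumProducts-++ : ∀ l₁ l₂ → sumProducts (l₁ ++ l₂) ≈ sumProducts l₁ + sumProducts l₂
    sumProducts-++ [] l₂ = sym (+-identityˡ _)
    sumProducts-++ (_ ∷ l₁) l₂ = trans (+-congˡ (sumProducts-++ l₁ l₂)) (sym (+-assoc _ _ _))

    scaleFirst : Carrier → List (Carrier × Carrier) → List (Carrier × Carrier)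
    scaleFirst r = map (λ ab → r * proj₁ ab , proj₂ ab)

    sumProducts-scale : ∀ r l → sumProducts (scaleFirst r l) ≈ r * sumProducts l
    sumProducts-scale r [] = sym (zeroʳ r)
    sumProducts-scale r ((a , b) ∷ l) =
      trans (+-cong (*-assoc r a b) (sumProducts-scale r l)) (sym (distribˡ r _ _))

  ·-intro : ∀ {A B a b} → A a → B b → (_·ₚ_ R A B) (a * b)
  ·-intro a∈A b∈B = (_ , _) ∷ [] , (a∈A , b∈B) ∷ [] , sym (+-identityʳ _)

  ·-elim : ∀ {T A B} → IsAdditiveSubmonoid T → (∀ a b → A a → B b → T (a * b)) → _⊆ₚ_ R (_·ₚ_ R A B) T
  ·-elim {T} {A} {B} T-add products∈T x (l , l∈A×B , x≈Σl) =
    respects T-add (sym x≈Σl) (sum∈T l l∈A×B)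
    where
    sum∈T : ∀ l → All (λ ab → A (proj₁ ab) × B (proj₂ ab)) l → T (sumProducts l)
    sum∈T [] [] = zero-mem T-add
    sum∈T ((a , b) ∷ l) ((a∈A , b∈B) ∷ l∈A×B) = sum-mem T-add (products∈T a b a∈A b∈B) (sum∈T l l∈A×B)

  _·ᴵ_ : Ideal R → RPred R → Ideal R
  I ·ᴵ B = record
    { mem = _·ₚ_ R (mem I) B
    ; resp = λ { y≈z (l , l∈ , y≈Σl) → l , l∈ , trans (sym y≈z) y≈Σl }
    ; has0 = [] , [] , refl
    ; closed+ = λ { (l₁ , a₁ , e₁) (l₂ , a₂ , e₂) →
        l₁ ++ l₂ , ++⁺ a₁ a₂ , trans (+-cong e₁ e₂) (sym (sumProducts-++ l₁ l₂)) }
    ; absorb = λ r → λ { (l , l∈ , e) →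
        scaleFirst r l , scale∈ r l l∈ , trans (*-congˡ e) (sym (sumProducts-scale r l)) }
    }
    where
    scale∈ : ∀ r l → All (λ ab → mem I (proj₁ ab) × B (proj₂ ab)) l →
             All (λ ab → mem I (proj₁ ab) × B (proj₂ ab)) (scaleFirst r l)
    scale∈ r [] [] = []
    scale∈ r _ ((a∈I , b∈B) ∷ l∈) = (absorb I r a∈I , b∈B) ∷ scale∈ r _ l∈

  _^ᴵ_ : Ideal R → ℕ → Ideal R
  I ^ᴵ n = record { mem = _^ₚ_ R (mem I) n ; resp = resp′ n ; has0 = has0′ n ; closed+ = closed+′ n ; absorb = absorb′ n }
    where
    resp′ : ∀ n {x y} → x ≈ y → _^ₚ_ R (mem I) n x → _^ₚ_ R (mem I) n y
    resp′ zero _ _ = lift tt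
    resp′ (suc n) = resp (I ·ᴵ _^ₚ_ R (mem I) n)
    has0′ : ∀ n → _^ₚ_ R (mem I) n 0#
    has0′ zero = lift tt
    has0′ (suc n) = has0 (I ·ᴵ _^ₚ_ R (mem I) n)
    closed+′ : ∀ n {x y} → _^ₚ_ R (mem I) n x → _^ₚ_ R (mem I) n y → _^ₚ_ R (mem I) n (x + y)
    closed+′ zero _ _ = lift tt
    closed+′ (suc n) = closed+ (I ·ᴵ _^ₚ_ R (mem I) n)
    absorb′ : ∀ n r {x} → _^ₚ_ R (mem I) n x → _^ₚ_ R (mem I) n (r * x)
    absorb′ zero _ _ = lift tt
    absorb′ (suc n) = absorb (I ·ᴵ _^ₚ_ R (mem I) n)

  module Powers (I : Ideal R) where

    I^ : ℕ → RPred R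
    I^ = _^ₚ_ R (mem I)

    ^-suc⊆ : ∀ n → _⊆ₚ_ R (I^ (suc n)) (mem I)
    ^-suc⊆ n = ·-elim (ideal⇒additive I) (λ a b a∈I _ → absorbʳ I b a∈I)

    pow∈^ : ∀ n {x} → mem I x → I^ n (pow R x n)
    pow∈^ zero _ = lift tt
    pow∈^ (suc n) x∈I = ·-intro x∈I (pow∈^ n x∈I)

    ^-+-elim : ∀ {T} → IsAdditiveSubmonoid T → ∀ m n →
               (∀ u v → I^ m u → I^ n v → T (u * v)) → _⊆ₚ_ R (I^ (m ℕ.+ n)) T
    ^-+-elim T-add zero n products∈T w w∈Iⁿ =
      respects T-add (*-identityˡ w) (products∈T 1# w (lift tt) w∈Iⁿ)
    ^-+-elim {T} T-add (suc m) n products∈T = ·-elim T-add x*I^m+n⊆T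
      where
      x*I^m+n⊆T : ∀ x y → mem I x → I^ (m ℕ.+ n) y → T (x * y)
      x*I^m+n⊆T x y x∈I = ^-+-elim x*T-add m n x*products∈T y
        where
        x*T-add : IsAdditiveSubmonoid (λ z → T (x * z))
        x*T-add = record
          { respects = λ z≈z′ → respects T-add (*-congˡ z≈z′)
          ; zero-mem = respects T-add (sym (zeroʳ x)) (zero-mem T-add)
          ; sum-mem = λ t t′ → respects T-add (sym (distribˡ x _ _)) (sum-mem T-add t t′) }
        x*products∈T : ∀ u v → I^ m u → I^ n v → T (x * (u * v))
        x*products∈T u v u∈Iᵐ v∈Iⁿ =
          respects T-add (*-assoc x u v) (products∈T (x * u) v (·-intro x∈I u∈Iᵐ) v∈Iⁿ)

  ⟨_⟩ : Carrier → Ideal R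
  ⟨ a ⟩ = record
    { mem = λ x → Σ Carrier λ r → x ≈ r * a
    ; resp = λ { x≈y (r , x≈ra) → r , trans (sym x≈y) x≈ra }
    ; has0 = 0# , sym (zeroˡ a)
    ; closed+ = λ { (r , e) (r′ , e′) → r + r′ , trans (+-cong e e′) (sym (distribʳ a r r′)) }
    ; absorb = λ r → λ { (r′ , e) → r * r′ , trans (*-congˡ e) (sym (*-assoc r r′ a)) } }

  ⟨⟩⊆ : ∀ {J : Ideal R} {a} → mem J a → _⊆ₚ_ R (mem ⟨ a ⟩) (mem J)
  ⟨⟩⊆ {J} a∈J x (r , x≈ra) = resp J (sym x≈ra) (absorb J r a∈J)

  _+⟨_⟩ : Ideal R → Carrier → Ideal R
  J +⟨ x ⟩ = record
    { mem = λ y → Σ Carrier λ i → Σ Carrier λ r → mem J i × y ≈ i + r * x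
    ; resp = λ { e (i , r , i∈J , e′) → i , r , i∈J , trans (sym e) e′ }
    ; has0 = 0# , 0# , has0 J , solve 1 (λ x → con (+ 0) := con (+ 0) :+ con (+ 0) :* x) refl x
    ; closed+ = λ { (i , r , i∈J , e) (i′ , r′ , i′∈J , e′) → i + i′ , r + r′ , closed+ J i∈J i′∈J ,
        trans (+-cong e e′)
          (solve 5 (λ i r i′ r′ x → (i :+ r :* x) :+ (i′ :+ r′ :* x) := (i :+ i′) :+ (r :+ r′) :* x) refl i r i′ r′ x) }
    ; absorb = λ t → λ { (i , r , i∈J , e) → t * i , t * r , absorb J t i∈J ,
        trans (*-congˡ e) (solve 4 (λ t i r x → t :* (i :+ r :* x) := t :* i :+ (t :* r) :* x) refl t i r x) } }

  ⊆+⟨⟩ : ∀ J x → _⊆_ R J (J +⟨ x ⟩)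
  ⊆+⟨⟩ J x y y∈J = y , 0# , y∈J , solve 2 (λ y x → y := y :+ con (+ 0) :* x) refl y x

  ∈+⟨⟩ : ∀ J x → mem (J +⟨ x ⟩) x
  ∈+⟨⟩ J x = 0# , 1# , has0 J , solve 1 (λ x → x := con (+ 0) :+ con (+ 1) :* x) refl x

  module _ (P : Ideal R) (P-prime : IsPrimeIdeal R P) where

    prime-∉-* : ∀ {a b} → ¬ mem P a → ¬ mem P b → ¬ mem P (a * b)
    prime-∉-* a∉P b∉P ab∈P with proj₂ P-prime _ _ ab∈P
    ... | inj₁ a∈P = a∉P a∈P
    ... | inj₂ b∈P = b∉P b∈P

    prime-∉-pow : ∀ {s} k → ¬ mem P s → ¬ mem P (pow R s k)
    prime-∉-pow zero _ = proj₁ P-prime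
    prime-∉-pow (suc k) s∉P = prime-∉-* s∉P (prime-∉-pow k s∉P)

  *-cancelˡ : IsIntegralDomain R → ∀ {a x y} → ¬ a ≈ 0# → a * x ≈ a * y → x ≈ y
  *-cancelˡ (_ , noZeroDivisors) {a} {x} {y} a≉0 ax≈ay
    with noZeroDivisors a (x - y) (trans (solve 3 (λ a x y → a :* (x :- y) := a :* x :- a :* y) refl a x y)
                                    (trans (+-congʳ ax≈ay) (-‿inverseʳ _)))
  ... | inj₁ a≈0 = ⊥-elim (a≉0 a≈0)
  ... | inj₂ x-y≈0 = x∙y⁻¹≈ε⇒x≈y x y x-y≈0
    where open import Algebra.Properties.Group +-group using (x∙y⁻¹≈ε⇒x≈y)

  -- π generates P after localising at P.
  record LocalUniformizer (P : Ideal R) : Set (c ⊔ ℓ) where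
    field
      π s    : Carrier
      π∈P    : mem P π
      π≉0    : ¬ π ≈ 0#
      s∉P    : ¬ mem P s
      sP⊆⟨π⟩ : ∀ x → mem P x → mem ⟨ π ⟩ (s * x)

  QuotCard≥2⇒1∉ : ∀ {J : Ideal R} {m} → QuotCard R (mem J) (suc (suc m)) → ¬ mem J 1#
  QuotCard≥2⇒1∉ {J} (residue , residue-injective , _) 1∈J
    with residue-injective fzero (fsuc fzero) (1∈⇒∈ J 1∈J _)
  ... | ()

module MaximalIdeals {c ℓ : Level} (R : CommutativeRing c ℓ) (P : Ideal R) (P-max : IsMaximalIdeal R P) where

  open CommutativeRing R
  open IntegerCoefficients R using (solve; _:+_; _:*_; :-_; _:-_; _:=_; con)
  open Ideals R
  open Powers P
  open import Relation.Binary.Reasoning.Setoid setoid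

  1∉P : ¬ mem P 1#
  1∉P = proj₁ P-max

  -- Maximality quantifies over all ideals, among them P + {x | A}, which is the
  -- whole ring exactly when A holds.
  excludedMiddle : ExcludedMiddle (c ⊔ ℓ)
  excludedMiddle {A} with proj₂ P-max P∨A (λ _ → inj₂)
    where
    P∨A : Ideal R
    P∨A = record
      { mem = λ x → A ⊎ mem P x
      ; resp = λ { _ (inj₁ a) → inj₁ a ; x≈y (inj₂ x∈P) → inj₂ (resp P x≈y x∈P) }
      ; has0 = inj₂ (has0 P)
      ; closed+ = λ { (inj₁ a) _ → inj₁ a ; (inj₂ _) (inj₁ a) → inj₁ a
                    ; (inj₂ x∈P) (inj₂ y∈P) → inj₂ (closed+ P x∈P y∈P) }
      ; absorb = λ { _ (inj₁ a) → inj₁ a ; r (inj₂ x∈P) → inj₂ (absorb P r x∈P) } }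
  ... | inj₁ P∨A⊆P = no (λ a → 1∉P (P∨A⊆P 1# (inj₁ a)))
  ... | inj₂ (inj₁ a) = yes a
  ... | inj₂ (inj₂ 1∈P) = ⊥-elim (1∉P 1∈P)

  doubleNegationElimination : DoubleNegationElimination (c ⊔ ℓ)
  doubleNegationElimination = em⇒dne excludedMiddle

  ∉⇒comaximal : ∀ {z} → ¬ mem P z → mem (P +⟨ z ⟩) 1#
  ∉⇒comaximal {z} z∉P with proj₂ P-max (P +⟨ z ⟩) (⊆+⟨⟩ P z)
  ... | inj₁ P+z⊆P = ⊥-elim (z∉P (P+z⊆P z (∈+⟨⟩ P z)))
  ... | inj₂ 1∈P+z = 1∈P+z

  private
    geometricSum : Carrier → ℕ → Carrier
    geometricSum e zero = 0#
    geometricSum e (suc k) = 1# + e * geometricSum e k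

    [1-e]*geometricSum : ∀ e k → (1# - e) * geometricSum e k ≈ 1# - pow R e k
    [1-e]*geometricSum e zero = solve 1 (λ e → (con (+ 1) :- e) :* con (+ 0) := con (+ 1) :- con (+ 1)) refl e
    [1-e]*geometricSum e (suc k) = begin
      (1# - e) * (1# + e * geometricSum e k)
        ≈⟨ solve 2 (λ e g → (con (+ 1) :- e) :* (con (+ 1) :+ e :* g) := (con (+ 1) :- e) :+ e :* ((con (+ 1) :- e) :* g)) refl e (geometricSum e k) ⟩
      (1# - e) + e * ((1# - e) * geometricSum e k)
        ≈⟨ +-congˡ (*-congˡ ([1-e]*geometricSum e k)) ⟩
      (1# - e) + e * (1# - pow R e k)
        ≈⟨ solve 2 (λ e q → (con (+ 1) :- e) :+ e :* (con (+ 1) :- q) := con (+ 1) :- e :* q) refl e (pow R e k) ⟩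
      1# - e * pow R e k ∎

  -- If 1 = i + r z with i ∈ P, then z · r (1 + i + ⋯ + i^(k-1)) = 1 - i^k ≡ 1 (mod P^k).
  ∉⇒unit-mod-^ : ∀ {z} → ¬ mem P z → ∀ k → IsUnitMod R (I^ k) z
  ∉⇒unit-mod-^ {z} z∉P k with ∉⇒comaximal z∉P
  ... | i , r , i∈P , 1≈i+rz = r * geometricSum i k ,
    resp (P ^ᴵ k) (sym z*inverse-1≈-iᵏ) (closed-neg (P ^ᴵ k) (pow∈^ k i∈P))
    where
    z*inverse-1≈-iᵏ : z * (r * geometricSum i k) - 1# ≈ - pow R i k
    z*inverse-1≈-iᵏ = begin
      z * (r * geometricSum i k) - 1#
        ≈⟨ +-congʳ (solve 3 (λ z r g → z :* (r :* g) := (r :* z) :* g) refl z r (geometricSum i k)) ⟩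
      (r * z) * geometricSum i k - 1#
        ≈⟨ +-congʳ (*-congʳ (solve 3 (λ r z i → r :* z := (i :+ r :* z) :- i) refl r z i)) ⟩
      ((i + r * z) - i) * geometricSum i k - 1#
        ≈⟨ +-cong (*-congʳ (+-congʳ (sym 1≈i+rz))) (-‿cong 1≈i+rz) ⟩
      (1# - i) * geometricSum i k - (i + r * z)
        ≈⟨ +-cong ([1-e]*geometricSum i k) (-‿cong (sym 1≈i+rz)) ⟩
      (1# - pow R i k) - 1#
        ≈⟨ solve 1 (λ q → (con (+ 1) :- q) :- con (+ 1) := :- q) refl (pow R i k) ⟩
      - pow R i k ∎

  cancel-∉ : ∀ {z w} k → ¬ mem P z → I^ k (z * w) → I^ k w
  cancel-∉ {z} {w} k z∉P zw∈Pᵏ = cancel (∉⇒unit-mod-^ z∉P k)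
    where
    cancel : IsUnitMod R (I^ k) z → I^ k w
    cancel (y , zy-1∈Pᵏ) = resp (P ^ᴵ k) w≈ (closed-sub (P ^ᴵ k) (absorb (P ^ᴵ k) y zw∈Pᵏ) (absorb (P ^ᴵ k) w zy-1∈Pᵏ))
      where
      w≈ : y * (z * w) - w * (z * y - 1#) ≈ w
      w≈ = solve 3 (λ w y z → y :* (z :* w) :- w :* (z :* y :- con (+ 1)) := w) refl w y z

module FiniteSums {c ℓ : Level} (R : CommutativeRing c ℓ) where

  open CommutativeRing R

  sumFin-cong : ∀ n {f g : Fin n → Carrier} → (∀ i → f i ≈ g i) → sumFin R n f ≈ sumFin R n g
  sumFin-cong zero f≈g = refl
  sumFin-cong (suc n) f≈g = +-cong (f≈g fzero) (sumFin-cong n (f≈g ∘ fsuc))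

  sumFin-*ˡ : ∀ n r (f : Fin n → Carrier) → sumFin R n (λ i → r * f i) ≈ r * sumFin R n f
  sumFin-*ˡ zero r f = sym (zeroʳ r)
  sumFin-*ˡ (suc n) r f = trans (+-congˡ (sumFin-*ˡ n r (f ∘ fsuc))) (sym (distribˡ r _ _))

  sumFin-snoc : ∀ n (f : Fin (suc n) → Carrier) → sumFin R (suc n) f ≈ sumFin R n (f ∘ inject₁) + f (fromℕ n)
  sumFin-snoc zero f = +-comm _ _
  sumFin-snoc (suc n) f = trans (+-congˡ (sumFin-snoc n (f ∘ fsuc))) (sym (+-assoc _ _ _))

  infixl 5 _∷ʳ_
  _∷ʳ_ : ∀ {n} → (Fin n → Carrier) → Carrier → Fin (suc n) → Carrier
  _∷ʳ_ {zero} f r _ = r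
  _∷ʳ_ {suc n} f r fzero = f fzero
  _∷ʳ_ {suc n} f r (fsuc i) = ((f ∘ fsuc) ∷ʳ r) i

  ∷ʳ-inject₁ : ∀ {n} (f : Fin n → Carrier) r i → (f ∷ʳ r) (inject₁ i) ≡.≡ f i
  ∷ʳ-inject₁ {suc n} f r fzero = ≡.refl
  ∷ʳ-inject₁ {suc n} f r (fsuc i) = ∷ʳ-inject₁ (f ∘ fsuc) r i

  ∷ʳ-fromℕ : ∀ {n} (f : Fin n → Carrier) r → (f ∷ʳ r) (fromℕ n) ≡.≡ r
  ∷ʳ-fromℕ {zero} f r = ≡.refl
  ∷ʳ-fromℕ {suc n} f r = ∷ʳ-fromℕ (f ∘ fsuc) r

  pow-+ : ∀ x m n → pow R x (m ℕ.+ n) ≈ pow R x m * pow R x n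
  pow-+ x zero n = sym (*-identityˡ _)
  pow-+ x (suc m) n = trans (*-congˡ (pow-+ x m n)) (sym (*-assoc _ _ _))

module Counting where

  open ≡ using (_≡_; _≢_; refl; sym; trans; cong; subst)

  private
    suc-if : Bool → ℕ → ℕ
    suc-if true n = suc n
    suc-if false n = n

  count : ∀ {N} → (Fin N → Bool) → ℕ
  count {zero} w = 0
  count {suc N} w = suc-if (w fzero) (count (w ∘ fsuc))

  record Enumeration {N} (w : Fin N → Bool) (k : ℕ) : Set where
    field
      at           : Fin k → Fin N
      at-true      : ∀ j → T (w (at j))
      at-injective : ∀ j j′ → at j ≡ at j′ → j ≡ j′
      index        : ∀ i → T (w i) → Fin k
      at-index     : ∀ i wi → at (index i wi) ≡ i

    index-injective : ∀ i i′ wi wi′ → index i wi ≡ index i′ wi′ → i ≡ i′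
    index-injective i i′ wi wi′ eq = trans (sym (at-index i wi)) (trans (cong at eq) (at-index i′ wi′))

  enumerate : ∀ {N} (w : Fin N → Bool) → Enumeration w (count w)
  enumerate {zero} w = record { at = λ () ; at-true = λ () ; at-injective = λ () ; index = λ () ; at-index = λ () }
  enumerate {suc N} w with w fzero in w0
  ... | true = record
    { at = λ { fzero → fzero ; (fsuc j) → fsuc (E.at j) }
    ; at-true = λ { fzero → subst T (sym w0) tt ; (fsuc j) → E.at-true j }
    ; at-injective = λ { fzero fzero _ → refl ; (fsuc j) (fsuc j′) eq → cong fsuc (E.at-injective j j′ (Fin.suc-injective eq)) }
    ; index = λ { fzero _ → fzero ; (fsuc i) wi → fsuc (E.index i wi) }
    ; at-index = λ { fzero _ → refl ; (fsuc i) wi → cong fsuc (E.at-index i wi) } }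
    where module E = Enumeration (enumerate (w ∘ fsuc))
  ... | false = record
    { at = fsuc ∘ E.at
    ; at-true = E.at-true
    ; at-injective = λ j j′ eq → E.at-injective j j′ (Fin.suc-injective eq)
    ; index = λ { fzero wi → ⊥-elim (subst T w0 wi) ; (fsuc i) wi → E.index i wi }
    ; at-index = λ { fzero wi → ⊥-elim (subst T w0 wi) ; (fsuc i) wi → cong fsuc (E.at-index i wi) } }
    where module E = Enumeration (enumerate (w ∘ fsuc))

  count≤ : ∀ {N t} (w : Fin N → Bool) (h : ∀ i → T (w i) → Fin t) →
           (∀ i i′ wi wi′ → h i wi ≡ h i′ wi′ → i ≡ i′) → count w ≤ t
  count≤ w h h-inj = ℕ.≮⇒≥ λ t<count → noCollision (Fin.pigeonhole t<count (λ j → h (at j) (at-true j)))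
    where
    open Enumeration (enumerate w)
    noCollision : ¬ Σ (Fin (count w)) λ j → Σ (Fin (count w)) λ j′ → j Fin.< j′ × h (at j) (at-true j) ≡ h (at j′) (at-true j′)
    noCollision (j , j′ , j<j′ , eq) = Fin.<⇒≢ j<j′ (at-injective j j′ (h-inj _ _ _ _ eq))

  count+count-not : ∀ {N} (w w′ : Fin N → Bool) → (∀ i → w′ i ≡ not (w i)) → count w ℕ.+ count w′ ≡ N
  count+count-not {zero} w w′ w′≡¬w = refl
  count+count-not {suc N} w w′ w′≡¬w with w fzero | w′ fzero | w′≡¬w fzero
  ... | true  | false | _ = cong suc rest
    where rest = count+count-not (w ∘ fsuc) (w′ ∘ fsuc) (w′≡¬w ∘ fsuc)
  ... | false | true  | _ = trans (ℕ.+-suc _ _) (cong suc rest)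
    where rest = count+count-not (w ∘ fsuc) (w′ ∘ fsuc) (w′≡¬w ∘ fsuc)

  count-cong : ∀ {N} {w w′ : Fin N → Bool} → (∀ i → w i ≡ w′ i) → count w ≡ count w′
  count-cong {zero} w≗w′ = refl
  count-cong {suc N} w≗w′ = ≡.cong₂ suc-if (w≗w′ fzero) (count-cong (w≗w′ ∘ fsuc))

  count-∘≤ : ∀ {N} (w : Fin N → Bool) (σ : Fin N → Fin N) → (∀ i j → σ i ≡ σ j → i ≡ j) → count (w ∘ σ) ≤ count w
  count-∘≤ w σ σ-inj = count≤ (w ∘ σ) (λ i wσi → index (σ i) wσi)
    (λ i i′ wσi wσi′ eq → σ-inj i i′ (index-injective (σ i) (σ i′) wσi wσi′ eq))
    where open Enumeration (enumerate w)

  module FixedPointFreeInvolution {N} (ι : Fin N → Fin N)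
    (ι-involutive : ∀ a → ι (ι a) ≡ a) (ι-noFixedPoint : ∀ a → ι a ≢ a) where

    private
      <ᵇ-flip : ∀ m n → m ≢ n → (n <ᵇ m) ≡ not (m <ᵇ n)
      <ᵇ-flip zero zero m≢n = ⊥-elim (m≢n refl)
      <ᵇ-flip zero (suc n) _ = refl
      <ᵇ-flip (suc m) zero _ = refl
      <ᵇ-flip (suc m) (suc n) m≢n = <ᵇ-flip m n (m≢n ∘ cong suc)

      ι-injective : ∀ a b → ι a ≡ ι b → a ≡ b
      ι-injective a b eq = trans (sym (ι-involutive a)) (trans (cong ι eq) (ι-involutive b))

    isRepresentative : Fin N → Bool
    isRepresentative a = toℕ a <ᵇ toℕ (ι a)

    isRepresentative-ι : ∀ a → isRepresentative (ι a) ≡ not (isRepresentative a)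
    isRepresentative-ι a = trans (cong (λ b → toℕ (ι a) <ᵇ toℕ b) (ι-involutive a))
      (<ᵇ-flip (toℕ a) (toℕ (ι a)) (λ eq → ι-noFixedPoint a (sym (Fin.toℕ-injective eq))))

    orbits : ℕ
    orbits = count isRepresentative

    orbits+orbits≡N : orbits ℕ.+ orbits ≡ N
    orbits+orbits≡N = trans (cong (orbits ℕ.+_) (ℕ.≤-antisym count≤count∘ι count∘ι≤count))
      (count+count-not isRepresentative (isRepresentative ∘ ι) isRepresentative-ι)
      where
      count∘ι≤count : count (isRepresentative ∘ ι) ≤ orbits
      count∘ι≤count = count-∘≤ isRepresentative ι ι-injective
      count≤count∘ι : orbits ≤ count (isRepresentative ∘ ι)
      count≤count∘ι = ≡.subst (_≤ count (isRepresentative ∘ ι))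
        (count-cong (λ a → cong isRepresentative (ι-involutive a)))
        (count-∘≤ (isRepresentative ∘ ι) ι ι-injective)

    private
      open Enumeration (enumerate isRepresentative) using (index; index-injective)

      ¬both : ∀ a → T (isRepresentative a) → T (isRepresentative (ι a)) → ⊥
      ¬both a ra rιa with isRepresentative a | isRepresentative-ι a
      ... | true | eq = subst T eq rιa

      Representative : Fin N → Set
      Representative a = Σ (Fin N) λ r → T (isRepresentative r) × (r ≡ a ⊎ r ≡ ι a)

      representative : ∀ a → Representative a
      representative a with isRepresentative a in ra
      ... | true = a , subst T (sym ra) tt , inj₁ refl
      ... | false = ι a , subst T (sym (trans (isRepresentative-ι a) (cong not ra))) tt , inj₂ refl

      representative-unique : ∀ a (r r′ : Representative a) → proj₁ r ≡ proj₁ r′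
      representative-unique a (_ , _ , inj₁ refl) (_ , _ , inj₁ refl) = refl
      representative-unique a (_ , _ , inj₂ refl) (_ , _ , inj₂ refl) = refl
      representative-unique a (_ , ra , inj₁ refl) (_ , rιa , inj₂ refl) = ⊥-elim (¬both a ra rιa)
      representative-unique a (_ , rιa , inj₂ refl) (_ , ra , inj₁ refl) = ⊥-elim (¬both a ra rιa)

      representative-ι : ∀ a → Representative (ι a) → Representative a
      representative-ι a (r , rr , inj₁ r≡ιa) = r , rr , inj₂ r≡ιa
      representative-ι a (r , rr , inj₂ r≡ιιa) = r , rr , inj₁ (trans r≡ιιa (ι-involutive a))

      representative-ι-same : ∀ a r → proj₁ (representative-ι a r) ≡ proj₁ r
      representative-ι-same a (_ , _ , inj₁ _) = refl
      representative-ι-same a (_ , _ , inj₂ _) = refl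

      index-cong : ∀ {a b} ra rb → a ≡ b → index a ra ≡ index b rb
      index-cong ra rb refl = cong (index _) (T-irrelevant ra rb)

    orbit : Fin N → Fin orbits
    orbit a = index (proj₁ (representative a)) (proj₁ (proj₂ (representative a)))

    orbit-ι : ∀ a → orbit (ι a) ≡ orbit a
    orbit-ι a = index-cong _ _ (trans (sym (representative-ι-same a (representative (ι a))))
      (representative-unique a (representative-ι a (representative (ι a))) (representative a)))

    orbit-injective : ∀ a b → orbit a ≡ orbit b → a ≡ b ⊎ a ≡ ι b
    orbit-injective a b eq with representative a | representative b
      | index-injective _ _ _ _ eq
    ... | _ , _ , inj₁ refl | _ , _ , inj₁ refl | a≡b = inj₁ a≡b
    ... | _ , _ , inj₁ refl | _ , _ , inj₂ refl | a≡ιb = inj₂ a≡ιb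
    ... | _ , _ , inj₂ refl | _ , _ , inj₁ refl | ιa≡b = inj₂ (trans (sym (ι-involutive a)) (cong ι ιa≡b))
    ... | _ , _ , inj₂ refl | _ , _ , inj₂ refl | ιa≡ιb = inj₁ (ι-injective a b ιa≡ιb)

    orbits≤ : ∀ {t} (h : Fin N → Fin t) → (∀ a b → h a ≡ h b → a ≡ b ⊎ a ≡ ι b) → orbits ≤ t
    orbits≤ h h-orbitwise = count≤ isRepresentative (λ a _ → h a) h-injective
      where
      h-injective : ∀ a b ra rb → h a ≡ h b → a ≡ b
      h-injective a b ra rb eq with h-orbitwise a b eq
      ... | inj₁ a≡b = a≡b
      ... | inj₂ refl = ⊥-elim (¬both b rb ra)

  least : ∀ {a} {A : ℕ → Set a} → (∀ t → Dec (A t)) → ∀ k → A k → Σ ℕ λ s → A s × (∀ t → A t → s ≤ t)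
  least {A = A} A? = <-rec Least least′
    where
    Least : ℕ → Set _
    Least k = A k → Σ ℕ λ s → A s × (∀ t → A t → s ≤ t)
    least′ : ∀ k → (∀ {t} → t < k → Least t) → Least k
    least′ k smaller Ak with ℕ.anyUpTo? A? k
    ... | yes (t , t<k , At) = smaller t<k At
    ... | no ¬smaller = k , Ak , λ t At → ℕ.≮⇒≥ (λ t<k → ¬smaller (t , t<k , At))

module NoetherianRings {c ℓ : Level} (R : CommutativeRing c ℓ) (noetherian : IsNoetherian R) where

  open CommutativeRing R
  open IntegerCoefficients R using (solve; _:+_; _:*_; :-_; _:-_; _:=_; con)
  open Ideals R
  open FiniteSums R
  open import Relation.Binary.Reasoning.Setoid setoid

  module _ (em : ExcludedMiddle (c ⊔ ℓ)) (Good : Ideal R → Set (c ⊔ ℓ)) where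

    private
      Extension : Ideal R → Set (c ⊔ ℓ)
      Extension J = Σ Carrier λ x → ¬ mem J x × Good (J +⟨ x ⟩)

      step : Σ (Ideal R) Good → Σ (Ideal R) Good
      step (J , good) with em {Extension J}
      ... | yes (x , _ , good′) = J +⟨ x ⟩ , good′
      ... | no _ = J , good

      step-⊆ : ∀ Jg → _⊆_ R (proj₁ Jg) (proj₁ (step Jg))
      step-⊆ (J , _) with em {Extension J}
      ... | yes (x , _ , _) = ⊆+⟨⟩ J x
      ... | no _ = λ _ x∈J → x∈J

      step-stuck : ∀ Jg → _⊆_ R (proj₁ (step Jg)) (proj₁ Jg) → ¬ Extension (proj₁ Jg)
      step-stuck (J , _) with em {Extension J}
      ... | yes (x , x∉J , _) = λ back _ → x∉J (back x (∈+⟨⟩ J x))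
      ... | no ¬extension = λ _ → ¬extension

    maximal-extension : ∀ J₀ → Good J₀ →
      Σ (Ideal R) λ J → Good J × _⊆_ R J₀ J × (∀ x → ¬ mem J x → ¬ Good (J +⟨ x ⟩))
    maximal-extension J₀ good₀ = proj₁ (chain N) , proj₂ (chain N) , J₀⊆chain N ,
      λ x x∉J good → step-stuck (chain N) stable (x , x∉J , good)
      where
      chain : ℕ → Σ (Ideal R) Good
      chain zero = J₀ , good₀
      chain (suc n) = step (chain n)

      J₀⊆chain : ∀ n → _⊆_ R J₀ (proj₁ (chain n))
      J₀⊆chain zero _ x∈J₀ = x∈J₀
      J₀⊆chain (suc n) x x∈J₀ = step-⊆ (chain n) x (J₀⊆chain n x x∈J₀)

      stabilises : Σ ℕ λ N → ∀ n → N ≤ n → _⊆_ R (proj₁ (chain n)) (proj₁ (chain N))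
      stabilises = noetherian (proj₁ ∘ chain) (step-⊆ ∘ chain)

      N : ℕ
      N = proj₁ stabilises

      stable : _⊆_ R (proj₁ (step (chain N))) (proj₁ (chain N))
      stable = proj₂ stabilises (suc N) (ℕ.n≤1+n N)

  -- The elements t₀ = a, tₖ₊₁ = (c′/a) tₖ of I generate an ascending chain
  -- (t₀) ⊆ (t₀, t₁) ⊆ ⋯; once it stabilises, t_M ∈ (t₀, …, t_{M-1}) is a monic
  -- equation of degree M for c′/a.
  module _ (domain : IsIntegralDomain R) (integrallyClosed : IsIntegrallyClosed R)
           {I : Ideal R} {a c′} (a≉0 : ¬ a ≈ 0#) (a∈I : mem I a)
           (c′I⊆aI : ∀ x → mem I x → Σ Carrier λ e → mem I e × c′ * x ≈ a * e) where

    private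
      sequence : ℕ → Σ Carrier (mem I)
      sequence zero = a , a∈I
      sequence (suc k) with c′I⊆aI (proj₁ (sequence k)) (proj₂ (sequence k))
      ... | e , e∈I , _ = e , e∈I

      t : ℕ → Carrier
      t k = proj₁ (sequence k)

      c′t≈at′ : ∀ k → c′ * t k ≈ a * t (suc k)
      c′t≈at′ k with c′I⊆aI (proj₁ (sequence k)) (proj₂ (sequence k))
      ... | _ , _ , eq = eq

      aᵏt≈c′ᵏa : ∀ k → pow R a k * t k ≈ pow R c′ k * a
      aᵏt≈c′ᵏa zero = refl
      aᵏt≈c′ᵏa (suc k) = begin
        (a * pow R a k) * t (suc k)   ≈⟨ solve 3 (λ a b c → (a :* b) :* c := b :* (a :* c)) refl a (pow R a k) (t (suc k)) ⟩
        pow R a k * (a * t (suc k))   ≈⟨ *-congˡ (c′t≈at′ k) ⟨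
        pow R a k * (c′ * t k)        ≈⟨ solve 3 (λ a b c → a :* (b :* c) := b :* (a :* c)) refl (pow R a k) c′ (t k) ⟩
        c′ * (pow R a k * t k)        ≈⟨ *-congˡ (aᵏt≈c′ᵏa k) ⟩
        c′ * (pow R c′ k * a)         ≈⟨ *-assoc _ _ _ ⟨
        (c′ * pow R c′ k) * a         ∎

      chain : ℕ → Ideal R
      chain zero = ⟨ t 0 ⟩
      chain (suc n) = chain n +⟨ t (suc n) ⟩

      t∈chain : ∀ n → mem (chain n) (t n)
      t∈chain zero = 1# , sym (*-identityˡ _)
      t∈chain (suc n) = ∈+⟨⟩ (chain n) (t (suc n))

      combination : ∀ n {x} → mem (chain n) x →
                    Σ (Fin (suc n) → Carrier) λ d → x ≈ sumFin R (suc n) (λ i → d i * t (toℕ i))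
      combination zero (r , x≈rt₀) = (λ _ → r) , trans x≈rt₀ (sym (+-identityʳ _))
      combination (suc n) {x} (y , r , y∈chain , x≈y+rt) with combination n y∈chain
      ... | d , y≈Σ = d ∷ʳ r , (begin
        x                                                    ≈⟨ x≈y+rt ⟩
        y + r * t (suc n)                                    ≈⟨ +-cong (trans y≈Σ (sumFin-cong (suc n) old)) new ⟩
        sumFin R (suc n) (term ∘ inject₁) + term (fromℕ (suc n)) ≈⟨ sumFin-snoc (suc n) term ⟨
        sumFin R (suc (suc n)) term                          ∎)
        where
        term : Fin (suc (suc n)) → Carrier
        term i = (d ∷ʳ r) i * t (toℕ i)
        old : ∀ i → d i * t (toℕ i) ≈ term (inject₁ i)
        old i = reflexive (≡.cong₂ (λ u v → u * t v) (≡.sym (∷ʳ-inject₁ d r i)) (≡.sym (Fin.toℕ-inject₁ i)))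
        new : r * t (suc n) ≈ term (fromℕ (suc n))
        new = reflexive (≡.cong₂ (λ u v → u * t v) (≡.sym (∷ʳ-fromℕ d r)) (≡.sym (Fin.toℕ-fromℕ (suc n))))

      stabilises : Σ ℕ λ N → ∀ n → N ≤ n → _⊆_ R (chain n) (chain N)
      stabilises = noetherian chain (λ n → ⊆+⟨⟩ (chain n) (t (suc n)))

      N M : ℕ
      N = proj₁ stabilises
      M = suc N

      relation : Σ (Fin M → Carrier) λ d → t M ≈ sumFin R M (λ i → d i * t (toℕ i))
      relation = combination N (proj₂ stabilises M (ℕ.n≤1+n N) (t M) (t∈chain M))

      d : Fin M → Carrier
      d = proj₁ relation

      term : Fin M → Carrier
      term i = d i * (pow R c′ (toℕ i) * pow R a (M ∸ toℕ i))

      aᴹ*dt≈a*term : ∀ i → pow R a M * (d i * t (toℕ i)) ≈ a * term i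
      aᴹ*dt≈a*term i = begin
        pow R a M * (d i * t (toℕ i))
          ≈⟨ *-congʳ (trans (reflexive (≡.cong (pow R a) (≡.sym (ℕ.m∸n+n≡m (ℕ.<⇒≤ (Fin.toℕ<n i)))))) (pow-+ a (M ∸ toℕ i) (toℕ i))) ⟩
        (pow R a (M ∸ toℕ i) * pow R a (toℕ i)) * (d i * t (toℕ i))
          ≈⟨ solve 4 (λ A B D T → (A :* B) :* (D :* T) := (D :* A) :* (B :* T)) refl (pow R a (M ∸ toℕ i)) (pow R a (toℕ i)) (d i) (t (toℕ i)) ⟩
        (d i * pow R a (M ∸ toℕ i)) * (pow R a (toℕ i) * t (toℕ i))
          ≈⟨ *-congˡ (aᵏt≈c′ᵏa (toℕ i)) ⟩
        (d i * pow R a (M ∸ toℕ i)) * (pow R c′ (toℕ i) * a)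
          ≈⟨ solve 4 (λ D A C a → (D :* A) :* (C :* a) := a :* (D :* (C :* A))) refl (d i) (pow R a (M ∸ toℕ i)) (pow R c′ (toℕ i)) a ⟩
        a * term i ∎

      a*c′ᴹ≈a*Σterm : a * pow R c′ M ≈ a * sumFin R M term
      a*c′ᴹ≈a*Σterm = begin
        a * pow R c′ M                                   ≈⟨ *-comm _ _ ⟩
        pow R c′ M * a                                   ≈⟨ aᵏt≈c′ᵏa M ⟨
        pow R a M * t M                                  ≈⟨ *-congˡ (proj₂ relation) ⟩
        pow R a M * sumFin R M (λ i → d i * t (toℕ i))   ≈⟨ sumFin-*ˡ M (pow R a M) (λ i → d i * t (toℕ i)) ⟨
        sumFin R M (λ i → pow R a M * (d i * t (toℕ i))) ≈⟨ sumFin-cong M aᴹ*dt≈a*term ⟩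
        sumFin R M (λ i → a * term i)                    ≈⟨ sumFin-*ˡ M a term ⟩
        a * sumFin R M term                              ∎

      monic : pow R c′ M + sumFin R M (λ i → (- d i) * (pow R c′ (toℕ i) * pow R a (M ∸ toℕ i))) ≈ 0#
      monic = *-cancelˡ domain a≉0 (begin
        a * (pow R c′ M + sumFin R M (λ i → (- d i) * (pow R c′ (toℕ i) * pow R a (M ∸ toℕ i))))
          ≈⟨ *-congˡ (+-congˡ (trans (sumFin-cong M (λ i → solve 2 (λ d x → (:- d) :* x := (:- con (+ 1)) :* (d :* x)) refl (d i) (pow R c′ (toℕ i) * pow R a (M ∸ toℕ i))))
                                     (sumFin-*ˡ M (- 1#) term))) ⟩
        a * (pow R c′ M + (- 1#) * sumFin R M term)
          ≈⟨ solve 3 (λ a X S → a :* (X :+ (:- con (+ 1)) :* S) := a :* X :- a :* S) refl a (pow R c′ M) (sumFin R M term) ⟩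
        a * pow R c′ M - a * sumFin R M term
          ≈⟨ +-congʳ a*c′ᴹ≈a*Σterm ⟩
        a * sumFin R M term - a * sumFin R M term
          ≈⟨ -‿inverseʳ _ ⟩
        0#
          ≈⟨ zeroʳ a ⟨
        a * 0# ∎)

    multiplier∈⟨⟩ : mem ⟨ a ⟩ c′
    multiplier∈⟨⟩ = integrallyClosed c′ a a≉0 (M , (λ i → - d i) , monic)

module DedekindPrimes {c ℓ : Level} (R : CommutativeRing c ℓ) (R-dedekind : IsDedekindDomain R)
  (P : Ideal R) (P≢0 : NonZeroIdeal R P) (P-prime : IsPrimeIdeal R P) where

  open CommutativeRing R
  open IsDedekindDomain R-dedekind
  open IntegerCoefficients R using (solve; _:+_; _:*_; :-_; _:-_; _:=_; con)
  open Ideals R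
  open Powers P
  open NoetherianRings R noetherian
  open import Relation.Binary.Reasoning.Setoid setoid

  P-max : IsMaximalIdeal R P
  P-max = dimLe1 P P-prime P≢0

  open MaximalIdeals R P P-max using (1∉P; excludedMiddle) renaming (doubleNegationElimination to dne)

  -- T contains Pⁿ after localising at P.
  ContainsLocalPower : ℕ → RPred R → Set (c ⊔ ℓ)
  ContainsLocalPower n T = Σ Carrier λ s → ¬ mem P s × (∀ z → I^ n z → T (s * z))

  ContainsSomeLocalPower : RPred R → Set (c ⊔ ℓ)
  ContainsSomeLocalPower T = Σ ℕ λ n → ContainsLocalPower n T

  ContainsLocalPower-* : ∀ {J : Ideal R} {x y} → ContainsSomeLocalPower (mem (J +⟨ x ⟩)) →
                         ContainsSomeLocalPower (mem (J +⟨ y ⟩)) → mem J (x * y) → ContainsSomeLocalPower (mem J)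
  ContainsLocalPower-* {J} {x} {y} (n₁ , s₁ , s₁∉P , s₁Pⁿ¹⊆) (n₂ , s₂ , s₂∉P , s₂Pⁿ²⊆) xy∈J =
    n₁ ℕ.+ n₂ , s₁ * s₂ , prime-∉-* P P-prime s₁∉P s₂∉P , ^-+-elim s₁s₂*J-additive n₁ n₂ s₁s₂uv∈J
    where
    s₁s₂*J-additive : IsAdditiveSubmonoid (λ w → mem J ((s₁ * s₂) * w))
    s₁s₂*J-additive = record
      { respects = λ w≈w′ → resp J (*-congˡ w≈w′)
      ; zero-mem = resp J (sym (zeroʳ _)) (has0 J)
      ; sum-mem = λ t t′ → resp J (sym (distribˡ _ _ _)) (closed+ J t t′) }
    s₁s₂uv∈J : ∀ u v → I^ n₁ u → I^ n₂ v → mem J ((s₁ * s₂) * (u * v))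
    s₁s₂uv∈J u v u∈Pⁿ¹ v∈Pⁿ² with s₁Pⁿ¹⊆ u u∈Pⁿ¹ | s₂Pⁿ²⊆ v v∈Pⁿ²
    ... | i , r , i∈J , s₁u≈i+rx | i′ , r′ , i′∈J , s₂v≈i′+r′y =
      resp J (sym expand) (closed+ J (absorb J (i′ + r′ * y) i∈J)
                            (closed+ J (absorb J (r * x) i′∈J) (absorb J (r * r′) xy∈J)))
      where
      expand : (s₁ * s₂) * (u * v) ≈ (i′ + r′ * y) * i + ((r * x) * i′ + (r * r′) * (x * y))
      expand = begin
        (s₁ * s₂) * (u * v)          ≈⟨ solve 4 (λ a b c d → (a :* b) :* (c :* d) := (a :* c) :* (b :* d)) refl s₁ s₂ u v ⟩
        (s₁ * u) * (s₂ * v)          ≈⟨ *-cong s₁u≈i+rx s₂v≈i′+r′y ⟩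
        (i + r * x) * (i′ + r′ * y)  ≈⟨ solve 6 (λ i r x i′ r′ y → (i :+ r :* x) :* (i′ :+ r′ :* y) :=
                                          (i′ :+ r′ :* y) :* i :+ ((r :* x) :* i′ :+ (r :* r′) :* (x :* y))) refl i r x i′ r′ y ⟩
        (i′ + r′ * y) * i + ((r * x) * i′ + (r * r′) * (x * y)) ∎

  -- An ideal J ⊇ (a) maximal among those not containing a local power of P is
  -- prime and inside P, so by dimension one it is P, which contains P¹.
  ⟨⟩-containsSomeLocalPower : ∀ {a} → mem P a → ¬ a ≈ 0# → ContainsSomeLocalPower (mem ⟨ a ⟩)
  ⟨⟩-containsSomeLocalPower {a} a∈P a≉0 =
    dne λ ¬power → absurd (maximal-extension excludedMiddle (λ J → ¬ ContainsSomeLocalPower (mem J)) ⟨ a ⟩ ¬power)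
    where
    absurd : ¬ Σ (Ideal R) λ J → ¬ ContainsSomeLocalPower (mem J) × _⊆_ R ⟨ a ⟩ J ×
                                 (∀ x → ¬ mem J x → ¬ ¬ ContainsSomeLocalPower (mem (J +⟨ x ⟩)))
    absurd (J , ¬powerJ , ⟨a⟩⊆J , maximal) =
      ¬powerJ (1 , 1# , 1∉P , λ z z∈P → P⊆J (1# * z) (resp P (sym (*-identityˡ z)) (^-suc⊆ 0 z z∈P)))
      where
      power⊆ : ∀ x → ¬ mem J x → ContainsSomeLocalPower (mem (J +⟨ x ⟩))
      power⊆ x x∉J = dne (maximal x x∉J)

      1∉J : ¬ mem J 1#
      1∉J 1∈J = ¬powerJ (0 , 1# , 1∉P , λ z _ → 1∈⇒∈ J 1∈J _)

      prime : ∀ x y → mem J (x * y) → mem J x ⊎ mem J y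
      prime x y xy∈J with excludedMiddle {mem J x} | excludedMiddle {mem J y}
      ... | yes x∈J | _ = inj₁ x∈J
      ... | no _ | yes y∈J = inj₂ y∈J
      ... | no x∉J | no y∉J = ⊥-elim (¬powerJ (ContainsLocalPower-* {J} (power⊆ x x∉J) (power⊆ y y∉J) xy∈J))

      J⊆P : _⊆_ R J P
      J⊆P x x∈J = dne λ x∉P → ¬powerJ (0 , x , x∉P , λ z _ → absorbʳ J z x∈J)

      P⊆J : _⊆_ R P J
      P⊆J = [ (λ P⊆J → P⊆J) , (λ 1∈P → ⊥-elim (1∉P 1∈P)) ]′
        (proj₂ (dimLe1 J (1∉J , prime) (a , ⟨a⟩⊆J a (1# , sym (*-identityˡ a)) , a≉0)) P J⊆P)

  -- From s P^(m+1) ⊆ (a) with m minimal, some s w with w ∈ Pᵐ lies outside (a)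
  -- but multiplies P into (a).
  conductor : ∀ {a} n → mem P a → ContainsLocalPower n (mem ⟨ a ⟩) →
              Σ Carrier λ c′ → (∀ x → mem P x → mem ⟨ a ⟩ (c′ * x)) × ¬ mem ⟨ a ⟩ c′
  conductor zero a∈P (s , s∉P , s*⊆⟨a⟩) =
    ⊥-elim (s∉P (resp P (*-identityʳ _) (⟨⟩⊆ {P} a∈P _ (s*⊆⟨a⟩ 1# (lift tt)))))
  conductor {a} (suc m) a∈P (s , s∉P , sPᵐ⁺¹⊆⟨a⟩) with excludedMiddle {ContainsLocalPower m (mem ⟨ a ⟩)}
  ... | yes sPᵐ⊆⟨a⟩ = conductor m a∈P sPᵐ⊆⟨a⟩
  ... | no ¬sPᵐ⊆⟨a⟩ with excludedMiddle {Σ Carrier λ w → I^ m w × ¬ mem ⟨ a ⟩ (s * w)}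
  ...   | yes (w , w∈Pᵐ , sw∉⟨a⟩) = s * w ,
          (λ x x∈P → resp ⟨ a ⟩ (solve 3 (λ s x w → s :* (x :* w) := (s :* w) :* x) refl s x w)
                        (sPᵐ⁺¹⊆⟨a⟩ (x * w) (·-intro x∈P w∈Pᵐ))) ,
          sw∉⟨a⟩
  ...   | no ¬w = ⊥-elim (¬sPᵐ⊆⟨a⟩ (s , s∉P , λ z z∈Pᵐ → dne λ sz∉⟨a⟩ → ¬w (z , z∈Pᵐ , sz∉⟨a⟩)))

  -- J = {x | a x ∈ a P + c′ P} contains P. J = P would make c′/a integral, so
  -- 1 ∈ J: a = a p₀ + c′ p₁, and π = p₁, s = 1 - p₀ localise P to (π).
  private
    module FromConductor {a c′} (a∈P : mem P a) (a≉0 : ¬ a ≈ 0#)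
      (c′P⊆⟨a⟩ : ∀ x → mem P x → mem ⟨ a ⟩ (c′ * x)) (c′∉⟨a⟩ : ¬ mem ⟨ a ⟩ c′) where

      J : Ideal R
      J = record
        { mem = λ x → Σ Carrier λ p₀ → Σ Carrier λ p₁ → mem P p₀ × mem P p₁ × a * x ≈ a * p₀ + c′ * p₁
        ; resp = λ { e (p₀ , p₁ , q₀ , q₁ , e′) → p₀ , p₁ , q₀ , q₁ , trans (*-congˡ (sym e)) e′ }
        ; has0 = 0# , 0# , has0 P , has0 P , solve 2 (λ a c → a :* con (+ 0) := a :* con (+ 0) :+ c :* con (+ 0)) refl a c′
        ; closed+ = λ { (p₀ , p₁ , q₀ , q₁ , e) (p₀′ , p₁′ , q₀′ , q₁′ , e′) →
            p₀ + p₀′ , p₁ + p₁′ , closed+ P q₀ q₀′ , closed+ P q₁ q₁′ ,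
            trans (distribˡ a _ _) (trans (+-cong e e′)
              (solve 6 (λ a c p q p′ q′ → (a :* p :+ c :* q) :+ (a :* p′ :+ c :* q′) := a :* (p :+ p′) :+ c :* (q :+ q′)) refl a c′ p₀ p₁ p₀′ p₁′)) }
        ; absorb = λ r → λ { {x} (p₀ , p₁ , q₀ , q₁ , e) → r * p₀ , r * p₁ , absorb P r q₀ , absorb P r q₁ ,
            trans (solve 3 (λ a r x → a :* (r :* x) := r :* (a :* x)) refl a r x)
              (trans (*-congˡ e) (solve 5 (λ r a p c q → r :* (a :* p :+ c :* q) := a :* (r :* p) :+ c :* (r :* q)) refl r a p₀ c′ p₁)) } }

      P⊆J : _⊆_ R P J
      P⊆J x x∈P = x , 0# , x∈P , has0 P , solve 3 (λ a x c → a :* x := a :* x :+ c :* con (+ 0)) refl a x c′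

      ¬J⊆P : ¬ _⊆_ R J P
      ¬J⊆P J⊆P = c′∉⟨a⟩ (multiplier∈⟨⟩ domain intClosed {I = P} a≉0 a∈P c′P⊆aP)
        where
        c′P⊆aP : ∀ x → mem P x → Σ Carrier λ e → mem P e × c′ * x ≈ a * e
        c′P⊆aP x x∈P with c′P⊆⟨a⟩ x x∈P
        ... | r , c′x≈ra = r , J⊆P r (0# , x , has0 P , x∈P , trans (*-comm a r) (trans (sym c′x≈ra)
                            (solve 3 (λ c x a → c :* x := a :* con (+ 0) :+ c :* x) refl c′ x a))) ,
                          trans c′x≈ra (*-comm r a)

      fromUnit : mem J 1# → LocalUniformizer P
      fromUnit (p₀ , p₁ , p₀∈P , p₁∈P , a1≈ap₀+c′p₁) =
        record { π = p₁ ; s = 1# - p₀ ; π∈P = p₁∈P ; π≉0 = p₁≉0 ; s∉P = s∉P ; sP⊆⟨π⟩ = sP⊆⟨p₁⟩ }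
        where
        s∉P : ¬ mem P (1# - p₀)
        s∉P s∈P = 1∉P (resp P (solve 1 (λ p → (con (+ 1) :- p) :+ p := con (+ 1)) refl p₀) (closed+ P s∈P p₀∈P))

        sP⊆⟨p₁⟩ : ∀ x → mem P x → mem ⟨ p₁ ⟩ ((1# - p₀) * x)
        sP⊆⟨p₁⟩ x x∈P with c′P⊆⟨a⟩ x x∈P
        ... | r , c′x≈ra = r , *-cancelˡ domain a≉0 (begin
          a * ((1# - p₀) * x)               ≈⟨ solve 3 (λ a p x → a :* ((con (+ 1) :- p) :* x) := (a :* con (+ 1) :- a :* p) :* x) refl a p₀ x ⟩
          (a * 1# - a * p₀) * x             ≈⟨ *-congʳ (+-congʳ a1≈ap₀+c′p₁) ⟩
          ((a * p₀ + c′ * p₁) - a * p₀) * x ≈⟨ solve 5 (λ a p c q x → ((a :* p :+ c :* q) :- a :* p) :* x := (c :* x) :* q) refl a p₀ c′ p₁ x ⟩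
          (c′ * x) * p₁                     ≈⟨ *-congʳ c′x≈ra ⟩
          (r * a) * p₁                      ≈⟨ solve 3 (λ r a q → (r :* a) :* q := a :* (r :* q)) refl r a p₁ ⟩
          a * (r * p₁)                      ∎)

        p₁≉0 : ¬ p₁ ≈ 0#
        p₁≉0 p₁≈0 with sP⊆⟨p₁⟩ a a∈P
        ... | r , sa≈rp₁ with proj₂ domain (1# - p₀) a (trans sa≈rp₁ (trans (*-congˡ p₁≈0) (zeroʳ r)))
        ...   | inj₁ s≈0 = s∉P (resp P (sym s≈0) (has0 P))
        ...   | inj₂ a≈0 = a≉0 a≈0

      uniformizer : LocalUniformizer P
      uniformizer = [ (λ J⊆P → ⊥-elim (¬J⊆P J⊆P)) , fromUnit ]′ (proj₂ P-max J P⊆J)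

  localUniformizer : LocalUniformizer P
  localUniformizer = fromConductor (conductor (proj₁ Pⁿ⊆⟨a⟩) a∈P (proj₂ Pⁿ⊆⟨a⟩))
    where
    a : Carrier
    a = proj₁ P≢0
    a∈P : mem P a
    a∈P = proj₁ (proj₂ P≢0)
    a≉0 : ¬ a ≈ 0#
    a≉0 = proj₂ (proj₂ P≢0)
    Pⁿ⊆⟨a⟩ : ContainsSomeLocalPower (mem ⟨ a ⟩)
    Pⁿ⊆⟨a⟩ = ⟨⟩-containsSomeLocalPower a∈P a≉0
    fromConductor : (Σ Carrier λ c′ → (∀ x → mem P x → mem ⟨ a ⟩ (c′ * x)) × ¬ mem ⟨ a ⟩ c′) → LocalUniformizer P
    fromConductor (c′ , c′P⊆⟨a⟩ , c′∉⟨a⟩) = FromConductor.uniformizer a∈P a≉0 c′P⊆⟨a⟩ c′∉⟨a⟩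

module PrimePowerQuotients {c ℓ : Level} (R : CommutativeRing c ℓ) (domain : IsIntegralDomain R)
  (P : Ideal R) (P-prime : IsPrimeIdeal R P) (P-max : IsMaximalIdeal R P) (U : Ideals.LocalUniformizer R P) where

  open CommutativeRing R
  open IntegerCoefficients R using (solve; _:+_; _:*_; :-_; _:-_; _:=_; con)
  open Ideals R
  open Powers P
  open MaximalIdeals R P P-max using (1∉P; ∉⇒unit-mod-^; cancel-∉)
  open LocalUniformizer U
  open ≡ using (_≡_; _≢_)
  open import Relation.Binary.Reasoning.Setoid setoid

  sᵏPᵏ⊆⟨πᵏ⟩ : ∀ k x → I^ k x → mem ⟨ pow R π k ⟩ (pow R s k * x)
  sᵏPᵏ⊆⟨πᵏ⟩ zero x _ = x , *-comm 1# x
  sᵏPᵏ⊆⟨πᵏ⟩ (suc k) = ·-elim (record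
    { respects = λ x≈y → resp ⟨ pow R π (suc k) ⟩ (*-congˡ x≈y)
    ; zero-mem = resp ⟨ pow R π (suc k) ⟩ (sym (zeroʳ _)) (has0 ⟨ pow R π (suc k) ⟩)
    ; sum-mem = λ {x} {y} sx∈ sy∈ → resp ⟨ pow R π (suc k) ⟩ (sym (distribˡ _ x y)) (closed+ ⟨ pow R π (suc k) ⟩ sx∈ sy∈) })
    λ a b a∈P b∈Pᵏ → product (sP⊆⟨π⟩ a a∈P) (sᵏPᵏ⊆⟨πᵏ⟩ k b b∈Pᵏ)
    where
    product : ∀ {a b} → mem ⟨ π ⟩ (s * a) → mem ⟨ pow R π k ⟩ (pow R s k * b) → mem ⟨ pow R π (suc k) ⟩ (pow R s (suc k) * (a * b))
    product {a} {b} (r₁ , sa≈r₁π) (r₂ , sᵏb≈r₂πᵏ) = r₁ * r₂ , (begin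
      (s * pow R s k) * (a * b)  ≈⟨ solve 4 (λ A B C D → (A :* B) :* (C :* D) := (A :* C) :* (B :* D)) refl s (pow R s k) a b ⟩
      (s * a) * (pow R s k * b)  ≈⟨ *-cong sa≈r₁π sᵏb≈r₂πᵏ ⟩
      (r₁ * π) * (r₂ * pow R π k) ≈⟨ solve 4 (λ A B C D → (A :* B) :* (C :* D) := (A :* C) :* (B :* D)) refl r₁ π r₂ (pow R π k) ⟩
      (r₁ * r₂) * (π * pow R π k) ∎)

  π-cancel : ∀ k z → I^ (suc k) (π * z) → I^ k z
  π-cancel k z πz∈Pᵏ⁺¹ = cancel (sᵏPᵏ⊆⟨πᵏ⟩ (suc k) (π * z) πz∈Pᵏ⁺¹)
    where
    cancel : mem ⟨ pow R π (suc k) ⟩ (pow R s (suc k) * (π * z)) → I^ k z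
    cancel (r , sᵏ⁺¹πz≈rπᵏ⁺¹) = cancel-∉ k (prime-∉-pow P P-prime (suc k) s∉P)
      (resp (P ^ᴵ k) (sym sᵏ⁺¹z≈rπᵏ) (absorb (P ^ᴵ k) r (pow∈^ k π∈P)))
      where
      sᵏ⁺¹z≈rπᵏ : pow R s (suc k) * z ≈ r * pow R π k
      sᵏ⁺¹z≈rπᵏ = *-cancelˡ domain π≉0 (begin
        π * (pow R s (suc k) * z) ≈⟨ solve 3 (λ a b c → a :* (b :* c) := b :* (a :* c)) refl π (pow R s (suc k)) z ⟩
        pow R s (suc k) * (π * z) ≈⟨ sᵏ⁺¹πz≈rπᵏ⁺¹ ⟩
        r * (π * pow R π k)       ≈⟨ solve 3 (λ a b c → a :* (b :* c) := b :* (a :* c)) refl r π (pow R π k) ⟩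
        π * (r * pow R π k)       ∎)

  π-divides-mod : ∀ k v → mem P v → Σ Carrier λ w → I^ k (v - π * w)
  π-divides-mod k v v∈P = divide (sP⊆⟨π⟩ v v∈P) (∉⇒unit-mod-^ s∉P k)
    where
    divide : mem ⟨ π ⟩ (s * v) → IsUnitMod R (I^ k) s → Σ Carrier λ w → I^ k (v - π * w)
    divide (r , sv≈rπ) (y , sy-1∈Pᵏ) = r * y , resp (P ^ᴵ k) (sym v-πry≈) (closed-neg (P ^ᴵ k) (absorb (P ^ᴵ k) v sy-1∈Pᵏ))
      where
      v-πry≈ : v - π * (r * y) ≈ - (v * (s * y - 1#))
      v-πry≈ = begin
        v - π * (r * y)  ≈⟨ +-congˡ (-‿cong (solve 3 (λ p r y → p :* (r :* y) := (r :* p) :* y) refl π r y)) ⟩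
        v - (r * π) * y  ≈⟨ +-congˡ (-‿cong (*-congʳ (sym sv≈rπ))) ⟩
        v - (s * v) * y  ≈⟨ solve 3 (λ v s y → v :- (s :* v) :* y := :- (v :* (s :* y :- con (+ 1)))) refl v s y ⟩
        - (v * (s * y - 1#)) ∎

  module Expansions {p : ℕ} (|R/P|≡p : QuotCard R (mem P) p) where

    digit : Fin p → Carrier
    digit = proj₁ |R/P|≡p

    digit-injective : ∀ i j → Cong R (mem P) (digit i) (digit j) → i ≡ j
    digit-injective = proj₁ (proj₂ |R/P|≡p)

    digitOf : ∀ x → Σ (Fin p) λ i → Cong R (mem P) x (digit i)
    digitOf = proj₂ (proj₂ |R/P|≡p)

    expansion : ∀ k → Fin (p ^ k) → Carrier
    expansion zero _ = 0#
    expansion (suc k) j = digit (proj₁ (remQuot {p} (p ^ k) j)) + π * expansion k (proj₂ (remQuot {p} (p ^ k) j))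

    expansion-combine : ∀ k d j → expansion (suc k) (combine d j) ≈ digit d + π * expansion k j
    expansion-combine k d j = reflexive (≡.cong (λ q → digit (proj₁ q) + π * expansion k (proj₂ q)) (Fin.remQuot-combine d j))

    private
      πx∈P : ∀ x → mem P (π * x)
      πx∈P x = resp P (*-comm x π) (absorb P x π∈P)

    -- Modulo P the expansions differ by their leading digits; what is left is a
    -- multiple of π, which π-cancel reduces to the shorter expansions.
    expansion-injective : ∀ k j j′ → I^ k (expansion k j - expansion k j′) → j ≡ j′
    expansion-injective zero fzero fzero _ = ≡.refl
    expansion-injective (suc k) j j′ diff∈Pᵏ⁺¹ =
      ≡.trans (≡.sym (Fin.combine-remQuot {p} (p ^ k) j))
        (≡.trans (≡.cong₂ combine d≡d′ i≡i′) (Fin.combine-remQuot {p} (p ^ k) j′))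
      where
      d d′ : Fin p
      d = proj₁ (remQuot {p} (p ^ k) j)
      d′ = proj₁ (remQuot {p} (p ^ k) j′)
      i i′ : Fin (p ^ k)
      i = proj₂ (remQuot {p} (p ^ k) j)
      i′ = proj₂ (remQuot {p} (p ^ k) j′)
      A B : Carrier
      A = expansion k i
      B = expansion k i′
      split : expansion (suc k) j - expansion (suc k) j′ ≈ (digit d - digit d′) + π * (A - B)
      split = solve 5 (λ a b p A B → (a :+ p :* A) :- (b :+ p :* B) := (a :- b) :+ p :* (A :- B)) refl (digit d) (digit d′) π A B
      d≡d′ : d ≡ d′
      d≡d′ = digit-injective d d′ (resp P (solve 2 (λ X Y → (X :+ Y) :- Y := X) refl (digit d - digit d′) (π * (A - B)))
               (closed-sub P (resp P split (^-suc⊆ k _ diff∈Pᵏ⁺¹)) (πx∈P (A - B))))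
      diff≈π[A-B] : expansion (suc k) j - expansion (suc k) j′ ≈ π * (A - B)
      diff≈π[A-B] = trans split (trans (+-congʳ (trans (+-congʳ (reflexive (≡.cong digit d≡d′))) (-‿inverseʳ (digit d′))))
                                       (+-identityˡ _))
      i≡i′ : i ≡ i′
      i≡i′ = expansion-injective k i i′ (π-cancel k (A - B) (resp (P ^ᴵ suc k) diff≈π[A-B] diff∈Pᵏ⁺¹))

    -- Read off the leading digit d of x, write x - d ≡ π w (mod Pᵏ⁺¹) and expand w.
    expansionOf : ∀ k x → Σ (Fin (p ^ k)) λ j → I^ k (x - expansion k j)
    expansionOf zero x = fzero , lift tt
    expansionOf (suc k) x = leading (digitOf x)
      where
      rest : ∀ d w → I^ (suc k) ((x - digit d) - π * w) → Σ (Fin (p ^ k)) (λ j → I^ k (w - expansion k j)) →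
             Σ (Fin (p ^ suc k)) λ j → I^ (suc k) (x - expansion (suc k) j)
      rest d w x-d-πw∈Pᵏ⁺¹ (j , w-e∈Pᵏ) = combine d j ,
        resp (P ^ᴵ suc k) (sym x-e≈) (closed+ (P ^ᴵ suc k) x-d-πw∈Pᵏ⁺¹ (·-intro π∈P w-e∈Pᵏ))
        where
        x-e≈ : x - expansion (suc k) (combine d j) ≈ ((x - digit d) - π * w) + π * (w - expansion k j)
        x-e≈ = trans (+-congˡ (-‿cong (expansion-combine k d j)))
          (solve 5 (λ x a p w r → x :- (a :+ p :* r) := ((x :- a) :- p :* w) :+ p :* (w :- r)) refl x (digit d) π w (expansion k j))
      tail : ∀ d → Σ Carrier (λ w → I^ (suc k) ((x - digit d) - π * w)) → Σ (Fin (p ^ suc k)) λ j → I^ (suc k) (x - expansion (suc k) j)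
      tail d (w , x-d-πw∈Pᵏ⁺¹) = rest d w x-d-πw∈Pᵏ⁺¹ (expansionOf k w)
      leading : (Σ (Fin p) λ d → Cong R (mem P) x (digit d)) → Σ (Fin (p ^ suc k)) λ j → I^ (suc k) (x - expansion (suc k) j)
      leading (d , x≡d) = tail d (π-divides-mod (suc k) (x - digit d) x≡d)

    |R/Pᵏ|≡pᵏ : ∀ k → QuotCard R (I^ k) (p ^ k)
    |R/Pᵏ|≡pᵏ k = expansion k , expansion-injective k , expansionOf k

  -- The units of R/Pᵏ⁺¹ are the expansions whose leading digit is not that of 0.
  module UnitExpansions {p₁ : ℕ} (|R/P|≡1+p₁ : QuotCard R (mem P) (suc p₁)) (k : ℕ) where

    open Expansions |R/P|≡1+p₁

    private
      p : ℕ
      p = suc p₁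

      zeroDigit : Fin p
      zeroDigit = proj₁ (digitOf 0#)

      zeroDigit∈P : mem P (digit zeroDigit)
      zeroDigit∈P = resp P (solve 1 (λ x → :- (con (+ 0) :- x) := x) refl (digit zeroDigit))
                      (closed-neg P (proj₂ (digitOf 0#)))

      leading∈P : ∀ d j → mem P (expansion (suc k) (combine d j)) → mem P (digit d)
      leading∈P d j e∈P = resp P (solve 2 (λ X Y → (X :+ Y) :- Y := X) refl (digit d) (π * expansion k j))
        (closed-sub P (resp P (expansion-combine k d j) e∈P) (resp P (*-comm _ π) (absorb P (expansion k j) π∈P)))

      zeroLeading∈P : ∀ j → mem P (expansion (suc k) (combine zeroDigit j))
      zeroLeading∈P j = resp P (sym (expansion-combine k zeroDigit j))
        (closed+ P zeroDigit∈P (resp P (*-comm _ π) (absorb P (expansion k j) π∈P)))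

      leading≢zero⇒∉P : ∀ d j → d ≢ zeroDigit → ¬ mem P (expansion (suc k) (combine d j))
      leading≢zero⇒∉P d j d≢0 e∈P = d≢0 (digit-injective d zeroDigit (closed-sub P (leading∈P d j e∈P) zeroDigit∈P))

      unitCode : Fin (p₁ ℕ.* p ^ k) → Fin (p ^ suc k)
      unitCode j = combine (punchIn zeroDigit (proj₁ (remQuot {p₁} (p ^ k) j))) (proj₂ (remQuot {p₁} (p ^ k) j))

      unitCode-injective : ∀ j j′ → unitCode j ≡ unitCode j′ → j ≡ j′
      unitCode-injective j j′ eq = ≡.trans (≡.sym (Fin.combine-remQuot {p₁} (p ^ k) j))
        (≡.trans (≡.cong₂ combine
                   (Fin.punchIn-injective zeroDigit _ _ (Fin.combine-injectiveˡ (punchIn zeroDigit (proj₁ q)) (proj₂ q) (punchIn zeroDigit (proj₁ q′)) (proj₂ q′) eq))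
                   (Fin.combine-injectiveʳ (punchIn zeroDigit (proj₁ q)) (proj₂ q) (punchIn zeroDigit (proj₁ q′)) (proj₂ q′) eq))
          (Fin.combine-remQuot {p₁} (p ^ k) j′))
        where
        q q′ : Fin p₁ × Fin (p ^ k)
        q = remQuot {p₁} (p ^ k) j
        q′ = remQuot {p₁} (p ^ k) j′

      unitCode-punchOut : ∀ d i (d≢0 : zeroDigit ≢ d) → unitCode (combine (punchOut d≢0) i) ≡ combine d i
      unitCode-punchOut d i d≢0 = ≡.trans
        (≡.cong (λ q → combine (punchIn zeroDigit (proj₁ q)) (proj₂ q)) (Fin.remQuot-combine (punchOut d≢0) i))
        (≡.cong (λ e → combine e i) (Fin.punchIn-punchOut d≢0))

    unit : Fin (p₁ ℕ.* p ^ k) → Carrier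
    unit j = expansion (suc k) (unitCode j)

    φ[R/Pᵏ⁺¹]≡p₁pᵏ : UnitCount R (I^ (suc k)) (p₁ ℕ.* p ^ k)
    φ[R/Pᵏ⁺¹]≡p₁pᵏ = unit , isUnit , injective , unitOf
      where
      isUnit : ∀ j → IsUnitMod R (I^ (suc k)) (unit j)
      isUnit j = ∉⇒unit-mod-^ (leading≢zero⇒∉P _ _ (Fin.punchInᵢ≢i zeroDigit _)) (suc k)

      injective : ∀ j j′ → Cong R (I^ (suc k)) (unit j) (unit j′) → j ≡ j′
      injective j j′ eq = unitCode-injective j j′ (expansion-injective (suc k) _ _ eq)

      unitOf : ∀ x → IsUnitMod R (I^ (suc k)) x → Σ (Fin (p₁ ℕ.* p ^ k)) λ j → Cong R (I^ (suc k)) x (unit j)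
      unitOf x x-unit = fromExpansion (expansionOf (suc k) x)
        where
        x∉P : ¬ mem P x
        x∉P x∈P = 1∉P (unit∈⇒1∈ P (IsUnitMod-mono (^-suc⊆ k) x-unit) x∈P)

        fromExpansion : (Σ (Fin (p ^ suc k)) λ j → I^ (suc k) (x - expansion (suc k) j)) →
                        Σ (Fin (p₁ ℕ.* p ^ k)) λ j → Cong R (I^ (suc k)) x (unit j)
        fromExpansion (j , x≡eⱼ) = combine (punchOut d≢0) i ,
          ≡.subst (λ j → Cong R (I^ (suc k)) x (expansion (suc k) j))
            (≡.sym (≡.trans (unitCode-punchOut d i d≢0) (Fin.combine-remQuot {p} (p ^ k) j))) x≡eⱼ
          where
          d : Fin p
          d = proj₁ (remQuot {p} (p ^ k) j)
          i : Fin (p ^ k)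
          i = proj₂ (remQuot {p} (p ^ k) j)
          d≢0 : zeroDigit ≢ d
          d≢0 0≡d = x∉P (Cong-mem P (^-suc⊆ k _ x≡eⱼ) (≡.subst (λ j → mem P (expansion (suc k) j))
            (≡.trans (≡.cong (λ e → combine e i) 0≡d) (Fin.combine-remQuot {p} (p ^ k) j)) (zeroLeading∈P i)))

module UnitEnumeration {c ℓ : Level} (R : CommutativeRing c ℓ) (em : ExcludedMiddle (c ⊔ ℓ)) where

  open Ideals R
  open Counting
  open ≡ using (_≡_)

  unitCount : (J : Ideal R) → ∀ {n} → QuotCard R (mem J) n → Σ ℕ (UnitCount R (mem J))
  unitCount J {n} (residue , residue-injective , residueIndex) = count isUnit ,
    residue ∘ at , (λ j → toWitness (at-true j)) ,
    (λ j j′ eq → at-injective j j′ (residue-injective _ _ eq)) , unitIndex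
    where
    isUnit : Fin n → Bool
    isUnit i = ⌊ em {IsUnitMod R (mem J) (residue i)} ⌋
    open Enumeration (enumerate isUnit)
    unitIndex : ∀ x → IsUnitMod R (mem J) x → Σ (Fin (count isUnit)) λ j → Cong R (mem J) x (residue (at j))
    unitIndex x ux with residueIndex x
    ... | i , x≋rᵢ = index i (fromWitness (IsUnitMod-resp J x≋rᵢ ux)) ,
      ≡.subst (λ k → Cong R (mem J) x (residue k)) (≡.sym (at-index i _)) x≋rᵢ

module UnitaryCayleyGraph {c ℓ : Level} (R : CommutativeRing c ℓ) (em : ExcludedMiddle (c ⊔ ℓ))
  (J : Ideal R) (1∉J : ¬ mem J (CommutativeRing.1# R))
  (n : ℕ) (|R/J|≡n : QuotCard R (mem J) n) (φ : ℕ) (φ[R/J]≡φ : UnitCount R (mem J) φ) where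

  open CommutativeRing R
  open IntegerCoefficients R using (solve; _:+_; _:*_; :-_; _:-_; _:=_; con)
  open Ideals R
  open ≡ using (_≡_; _≢_; cong; cong₂; subst)
  open Counting

  private
    infix 4 _≋_ _~_
    _≋_ : Carrier → Carrier → Set (c ⊔ ℓ)
    _≋_ = Cong R (mem J)

    _~_ : Carrier → Carrier → Set (c ⊔ ℓ)
    _~_ = Adj R (mem J)

    residue : Fin n → Carrier
    residue = proj₁ |R/J|≡n

    unit : Fin φ → Carrier
    unit = proj₁ φ[R/J]≡φ

    residue-injective : ∀ i j → residue i ≋ residue j → i ≡ j
    residue-injective = proj₁ (proj₂ |R/J|≡n)

    unit-injective : ∀ i j → unit i ≋ unit j → i ≡ j
    unit-injective = proj₁ (proj₂ (proj₂ φ[R/J]≡φ))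

    unit-isUnit : ∀ i → IsUnitMod R (mem J) (unit i)
    unit-isUnit = proj₁ (proj₂ φ[R/J]≡φ)

    residueIndex : Carrier → Fin n
    residueIndex x = proj₁ (proj₂ (proj₂ |R/J|≡n) x)

    residueIndex-spec : ∀ x → x ≋ residue (residueIndex x)
    residueIndex-spec x = proj₂ (proj₂ (proj₂ |R/J|≡n) x)

    residueIndex-cong : ∀ {x x′} → x ≋ x′ → residueIndex x ≡ residueIndex x′
    residueIndex-cong {x} {x′} x≋x′ = residue-injective _ _
      (Cong-trans J (Cong-sym J (residueIndex-spec x)) (Cong-trans J x≋x′ (residueIndex-spec x′)))

    residueIndex-residue : ∀ i → residueIndex (residue i) ≡ i
    residueIndex-residue i = residue-injective _ _ (Cong-sym J (residueIndex-spec (residue i)))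

    unitIndex : ∀ x → IsUnitMod R (mem J) x → Fin φ
    unitIndex x ux = proj₁ (proj₂ (proj₂ (proj₂ φ[R/J]≡φ)) x ux)

    unitIndex-spec : ∀ x ux → x ≋ unit (unitIndex x ux)
    unitIndex-spec x ux = proj₂ (proj₂ (proj₂ (proj₂ φ[R/J]≡φ)) x ux)

    unitIndex-cong : ∀ {x x′} ux ux′ → x ≋ x′ → unitIndex x ux ≡ unitIndex x′ ux′
    unitIndex-cong {x} {x′} ux ux′ x≋x′ = unit-injective _ _
      (Cong-trans J (Cong-sym J (unitIndex-spec x ux)) (Cong-trans J x≋x′ (unitIndex-spec x′ ux′)))

    unitIndex-unit : ∀ i ui → unitIndex (unit i) ui ≡ i
    unitIndex-unit i ui = unit-injective _ _ (Cong-sym J (unitIndex-spec (unit i) ui))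

  -- A directed edge x → y of G_{R/J} is coded by the residue of x and the unit x - y.
  Arc : Set
  Arc = Fin (n ℕ.* φ)

  tail : Arc → Carrier
  tail a = residue (proj₁ (remQuot {n} φ a))

  head : Arc → Carrier
  head a = tail a - unit (proj₂ (remQuot {n} φ a))

  tail~head : ∀ a → tail a ~ head a
  tail~head a = IsUnitMod-resp J
    (Cong-reflexive J (solve 2 (λ u x → u := x :- (x :- u)) refl (unit (proj₂ (remQuot {n} φ a))) (tail a)))
    (unit-isUnit _)

  arc : ∀ x y → x ~ y → Arc
  arc x y x~y = combine (residueIndex x) (unitIndex (x - y) x~y)

  arc-cong : ∀ {x x′ y y′} → x ≋ x′ → y ≋ y′ → ∀ x~y x′~y′ → arc x y x~y ≡ arc x′ y′ x′~y′
  arc-cong x≋x′ y≋y′ x~y x′~y′ = cong₂ combine (residueIndex-cong x≋x′) (unitIndex-cong x~y x′~y′ (Cong-sub J x≋x′ y≋y′))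

  arc-tail-head : ∀ a t~h → arc (tail a) (head a) t~h ≡ a
  arc-tail-head a t~h = ≡.trans
    (cong₂ combine (residueIndex-residue _)
      (≡.trans (unitIndex-cong t~h (unit-isUnit _) (Cong-reflexive J (solve 2 (λ x u → x :- (x :- u) := u) refl (tail a) _)))
        (unitIndex-unit _ _)))
    (Fin.combine-remQuot {n} φ a)

  tail-arc : ∀ x y x~y → tail (arc x y x~y) ≋ x
  tail-arc x y x~y = subst (λ q → residue (proj₁ q) ≋ x)
    (≡.sym (Fin.remQuot-combine (residueIndex x) (unitIndex (x - y) x~y))) (Cong-sym J (residueIndex-spec x))

  head-arc : ∀ x y x~y → head (arc x y x~y) ≋ y
  head-arc x y x~y = subst (λ q → residue (proj₁ q) - unit (proj₂ q) ≋ y)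
    (≡.sym (Fin.remQuot-combine (residueIndex x) (unitIndex (x - y) x~y)))
    (Cong-trans J (Cong-sub J (Cong-sym J (residueIndex-spec x)) (Cong-sym J (unitIndex-spec (x - y) x~y)))
      (Cong-reflexive J (solve 2 (λ x y → x :- (x :- y) := y) refl x y)))

  arc-injective : ∀ {x y u v} x~y u~v → arc x y x~y ≡ arc u v u~v → x ≋ u × y ≋ v
  arc-injective {x} {y} {u} {v} x~y u~v eq = x≋u ,
    resp J (solve 4 (λ x y u v → (x :- u) :- ((x :- y) :- (u :- v)) := y :- v) refl x y u v) (closed-sub J x≋u x-y≋u-v)
    where
    x≋u : x ≋ u
    x≋u = Cong-trans J (residueIndex-spec x)
      (subst (λ i → residue i ≋ u) (≡.sym (Fin.combine-injectiveˡ (residueIndex x) _ (residueIndex u) _ eq)) (Cong-sym J (residueIndex-spec u)))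
    x-y≋u-v : (x - y) ≋ (u - v)
    x-y≋u-v = Cong-trans J (unitIndex-spec _ x~y)
      (subst (λ i → unit i ≋ (u - v)) (≡.sym (Fin.combine-injectiveʳ (residueIndex x) _ (residueIndex u) _ eq)) (Cong-sym J (unitIndex-spec _ u~v)))

  -- Kept abstract: unfolding it inside arc codes makes type checking very slow.
  abstract
    reverse : Arc → Arc
    reverse a = arc (head a) (tail a) (Adj-sym J (tail~head a))

    reverse-arc : ∀ x y x~y y~x → reverse (arc x y x~y) ≡ arc y x y~x
    reverse-arc x y x~y = arc-cong (head-arc x y x~y) (tail-arc x y x~y) _

    reverse-tail-head : ∀ a → reverse a ≡ arc (head a) (tail a) (Adj-sym J (tail~head a))
    reverse-tail-head a = ≡.refl

  reverse-involutive : ∀ a → reverse (reverse a) ≡ a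
  reverse-involutive a = ≡.trans (cong reverse (reverse-tail-head a))
    (≡.trans (reverse-arc (head a) (tail a) _ (tail~head a)) (arc-tail-head a _))

  -- An arc equal to its reverse would join two vertices congruent mod J, but 1 ∉ J.
  reverse-noFixedPoint : ∀ a → reverse a ≢ a
  reverse-noFixedPoint a eq = Cong⇒¬Adj J 1∉J (Cong-sym J h≋t) (tail~head a)
    where
    h≋t : head a ≋ tail a
    h≋t = proj₁ (arc-injective (Adj-sym J (tail~head a)) (tail~head a)
      (≡.trans (≡.sym (reverse-tail-head a)) (≡.trans eq (≡.sym (arc-tail-head a (tail~head a))))))

  open FixedPointFreeInvolution reverse reverse-involutive reverse-noFixedPoint public
    using (orbits)
  open FixedPointFreeInvolution reverse reverse-involutive reverse-noFixedPoint
    using (orbits+orbits≡N; orbit; orbit-ι; orbit-injective; orbits≤)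

  2*orbits≡n*φ : 2 ℕ.* orbits ≡ n ℕ.* φ
  2*orbits≡n*φ = ≡.trans (≡.cong (orbits ℕ.+_) (ℕ.+-identityʳ orbits)) orbits+orbits≡N

  private
    1~0 : 1# ~ 0#
    1~0 = 1# , Cong-reflexive J (solve 0 ((con (+ 1) :- con (+ 0)) :* con (+ 1) := con (+ 1)) refl)

  -- Every edge gets a colour of its own: the orbit of its two orientations.
  edgeColour : Carrier → Carrier → Fin orbits
  edgeColour x y with em {x ~ y}
  ... | yes x~y = orbit (arc x y x~y)
  ... | no _ = orbit (arc 1# 0# 1~0)

  edgeColour-cong : ∀ x x′ y y′ → x ≋ x′ → y ≋ y′ → edgeColour x y ≡ edgeColour x′ y′
  edgeColour-cong x x′ y y′ x≋x′ y≋y′ with em {x ~ y} | em {x′ ~ y′}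
  ... | yes x~y | yes x′~y′ = cong orbit (arc-cong x≋x′ y≋y′ x~y x′~y′)
  ... | yes x~y | no x′≁y′ = ⊥-elim (x′≁y′ (Adj-resp J x≋x′ y≋y′ x~y))
  ... | no x≁y | yes x′~y′ = ⊥-elim (x≁y (Adj-resp J (Cong-sym J x≋x′) (Cong-sym J y≋y′) x′~y′))
  ... | no _ | no _ = ≡.refl

  edgeColour-sym : ∀ x y → edgeColour x y ≡ edgeColour y x
  edgeColour-sym x y with em {x ~ y} | em {y ~ x}
  ... | yes x~y | yes y~x = ≡.trans (≡.sym (orbit-ι (arc x y x~y))) (cong orbit (reverse-arc x y x~y y~x))
  ... | yes x~y | no y≁x = ⊥-elim (y≁x (Adj-sym J x~y))
  ... | no x≁y | yes y~x = ⊥-elim (x≁y (Adj-sym J y~x))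
  ... | no _ | no _ = ≡.refl

  edgeColour-injective : ∀ x y u v → x ~ y → u ~ v → edgeColour x y ≡ edgeColour u v → SameEdge R (mem J) x y u v
  edgeColour-injective x y u v x~y u~v with em {x ~ y} | em {u ~ v}
  ... | no x≁y | _ = ⊥-elim (x≁y x~y)
  ... | yes _ | no u≁v = ⊥-elim (u≁v u~v)
  ... | yes x~y | yes u~v = λ eq → sameEdge (orbit-injective _ _ eq)
    where
    sameEdge : arc x y x~y ≡ arc u v u~v ⊎ arc x y x~y ≡ reverse (arc u v u~v) → SameEdge R (mem J) x y u v
    sameEdge (inj₁ eq) = inj₁ (arc-injective x~y u~v eq)
    sameEdge (inj₂ eq) = inj₂ (arc-injective x~y (Adj-sym J u~v) (≡.trans eq (reverse-arc u v u~v (Adj-sym J u~v))))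

  strongEdgeColoring : StrongEdgeColoring R (mem J) orbits
  strongEdgeColoring = edgeColour , edgeColour-cong , edgeColour-sym ,
    λ x y u v x~y u~v ¬same _ eq → ¬same (edgeColour-injective x y u v x~y u~v eq)

  -- If any two edges are joined by an edge, a strong edge colouring must give
  -- distinct edges distinct colours.
  orbits≤-if-edges-close : (∀ x y u v → x ~ y → u ~ v → x ~ u ⊎ x ~ v ⊎ y ~ u ⊎ y ~ v) →
                           ∀ t → StrongEdgeColoring R (mem J) t → orbits ≤ t
  orbits≤-if-edges-close close t (colour , _ , _ , strong) = orbits≤ (λ a → colour (tail a) (head a)) sameOrbit
    where
    sameOrbit : ∀ a b → colour (tail a) (head a) ≡ colour (tail b) (head b) → a ≡ b ⊎ a ≡ reverse b
    sameOrbit a b eq with em {SameEdge R (mem J) (tail a) (head a) (tail b) (head b)}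
    ... | no ¬same = ⊥-elim (strong _ _ _ _ (tail~head a) (tail~head b) ¬same
                      (close _ _ _ _ (tail~head a) (tail~head b)) eq)
    ... | yes (inj₁ (ta≋tb , ha≋hb)) = inj₁ (≡.trans (≡.sym (arc-tail-head a (tail~head a)))
                                        (≡.trans (arc-cong ta≋tb ha≋hb _ _) (arc-tail-head b (tail~head b))))
    ... | yes (inj₂ (ta≋hb , ha≋tb)) = inj₂ (≡.trans (≡.sym (arc-tail-head a (tail~head a)))
                                        (≡.trans (arc-cong ta≋hb ha≋tb _ _) (≡.sym (reverse-tail-head b))))

module PrimePowerGraph {c ℓ : Level} (R : CommutativeRing c ℓ) (R-dedekind : IsDedekindDomain R)
  (P : Ideal R) (P≢0 : NonZeroIdeal R P) (P-prime : IsPrimeIdeal R P)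
  {p₁ : ℕ} (|R/P|≡1+p₁ : QuotCard R (mem P) (suc p₁)) (k : ℕ) where

  open CommutativeRing R
  open IntegerCoefficients R using (solve; _:+_; _:*_; :-_; _:-_; _:=_; con)
  open Ideals R
  open Powers P
  open IsDedekindDomain R-dedekind using (domain)
  open DedekindPrimes R R-dedekind P P≢0 P-prime using (P-max; localUniformizer)
  open MaximalIdeals R P P-max using (1∉P; excludedMiddle; ∉⇒unit-mod-^)
  open PrimePowerQuotients R domain P P-prime P-max localUniformizer
  open Expansions |R/P|≡1+p₁ using (|R/Pᵏ|≡pᵏ)
  open UnitExpansions |R/P|≡1+p₁ k using (φ[R/Pᵏ⁺¹]≡p₁pᵏ)
  open ≡ using (_≡_)

  p α : ℕ
  p = suc p₁
  α = suc k

  1∉Pᵅ : ¬ mem (P ^ᴵ α) 1#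
  1∉Pᵅ 1∈Pᵅ = 1∉P (^-suc⊆ k 1# 1∈Pᵅ)

  |R/Pᵅ|≡pᵅ : QuotCard R (I^ α) (p ^ α)
  |R/Pᵅ|≡pᵅ = |R/Pᵏ|≡pᵏ α

  φ[R/Pᵅ]≡p₁pᵏ : UnitCount R (I^ α) (p₁ ℕ.* p ^ k)
  φ[R/Pᵅ]≡p₁pᵏ = φ[R/Pᵏ⁺¹]≡p₁pᵏ

  open UnitaryCayleyGraph R excludedMiddle (P ^ᴵ α) 1∉Pᵅ (p ^ α) |R/Pᵅ|≡pᵅ (p₁ ℕ.* p ^ k) φ[R/Pᵅ]≡p₁pᵏ
    using (orbits; 2*orbits≡n*φ; strongEdgeColoring; orbits≤-if-edges-close) public

  -- G_{R/Pᵅ} is complete multipartite with the classes mod P as parts, so any two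
  -- edges are joined: if x ≡ u (mod P) then x ≢ v, as u and v lie in different parts.
  edgesClose : ∀ x y u v → Adj R (I^ α) x y → Adj R (I^ α) u v →
               Adj R (I^ α) x u ⊎ Adj R (I^ α) x v ⊎ Adj R (I^ α) y u ⊎ Adj R (I^ α) y v
  edgesClose x y u v _ u~v with excludedMiddle {mem P (x - u)}
  ... | no x≢u = inj₁ (∉⇒unit-mod-^ x≢u α)
  ... | yes x≡u = inj₂ (inj₁ (∉⇒unit-mod-^ x≢v α))
    where
    x≢v : ¬ mem P (x - v)
    x≢v x≡v = Cong⇒¬Adj P 1∉P (resp P (solve 3 (λ x u v → (x :- v) :- (x :- u) := u :- v) refl x u v) (closed-sub P x≡v x≡u))
                              (IsUnitMod-mono (^-suc⊆ k) u~v)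

  s′[R/Pᵅ]≡orbits : IsStrongChromaticIndex R (I^ α) orbits
  s′[R/Pᵅ]≡orbits = strongEdgeColoring , orbits≤-if-edges-close edgesClose

module ProductGraph {c ℓ : Level} (R : CommutativeRing c ℓ)
  (Q M : Ideal R) (Q-max : IsMaximalIdeal R Q) (M⊈Q : ¬ _⊆_ R M Q)
  {m₂ : ℕ} (|R/M|≡2+m₂ : QuotCard R (mem M) (suc (suc m₂))) (|R/Q|≡2 : QuotCard R (mem Q) 2) where

  open CommutativeRing R
  open IntegerCoefficients R using (solve; _:+_; _:*_; :-_; _:-_; _:=_; con)
  open Ideals R
  open MaximalIdeals R Q Q-max using (excludedMiddle; doubleNegationElimination; ∉⇒comaximal)
    renaming (1∉P to 1∉Q)
  open import Relation.Binary.Reasoning.Setoid setoid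
  open ≡ using (_≡_; _≢_)

  QM : RPred R
  QM = mem (Q ·ᴵ mem M)

  private
    infix 4 _≡Q_ _≡M_ _~_
    _≡Q_ _≡M_ _~_ : Carrier → Carrier → Set (c ⊔ ℓ)
    _≡Q_ = Cong R (mem Q)
    _≡M_ = Cong R (mem M)
    _~_ = Adj R QM

    1∉M : ¬ mem M 1#
    1∉M = QuotCard≥2⇒1∉ {M} |R/M|≡2+m₂

  QM⊆M : _⊆ₚ_ R QM (mem M)
  QM⊆M = ·-elim (ideal⇒additive M) (λ a b _ b∈M → absorb M a b∈M)

  QM⊆Q : _⊆ₚ_ R QM (mem Q)
  QM⊆Q = ·-elim (ideal⇒additive Q) (λ a b a∈Q _ → absorbʳ Q b a∈Q)

  -- Q and M are comaximal: 1 = i + m with i ∈ Q, m ∈ M, so z = i z + z m ∈ Q M.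
  Q∩M⊆QM : ∀ z → mem Q z → mem M z → QM z
  Q∩M⊆QM z z∈Q z∈M = split (doubleNegationElimination λ M⊆Q′ → M⊈Q λ x x∈M →
                                doubleNegationElimination λ x∉Q → M⊆Q′ (x , x∈M , x∉Q))
    where
    split : (Σ Carrier λ x → mem M x × ¬ mem Q x) → QM z
    split (x , x∈M , x∉Q) = fromComaximal (∉⇒comaximal x∉Q)
      where
      fromComaximal : mem (Q +⟨ x ⟩) 1# → QM z
      fromComaximal (i , r , i∈Q , 1≈i+rx) =
        (i , z) ∷ (z , r * x) ∷ [] , (i∈Q , z∈M) ∷ (z∈Q , absorb M r x∈M) ∷ [] , (begin
          z                        ≈⟨ *-identityʳ z ⟨
          z * 1#                   ≈⟨ *-congˡ 1≈i+rx ⟩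
          z * (i + r * x)          ≈⟨ solve 3 (λ z i m → z :* (i :+ m) := i :* z :+ (z :* m :+ con (+ 0))) refl z i (r * x) ⟩
          i * z + (z * (r * x) + 0#) ∎)

  private
    classOf : Carrier → Fin 2
    classOf x = proj₁ (proj₂ (proj₂ |R/Q|≡2) x)

    sameClass⇒≡Q : ∀ {a b} → classOf a ≡ classOf b → a ≡Q b
    sameClass⇒≡Q {a} {b} eq = Cong-trans Q (proj₂ (proj₂ (proj₂ |R/Q|≡2) a))
      (≡.subst (λ i → proj₁ |R/Q|≡2 i ≡Q b) (≡.sym eq) (Cong-sym Q (proj₂ (proj₂ (proj₂ |R/Q|≡2) b))))

    fin2-pigeonhole : ∀ (i j l : Fin 2) → i ≢ j → i ≢ l → j ≡ l
    fin2-pigeonhole fzero fzero _ i≢j _ = ⊥-elim (i≢j ≡.refl)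
    fin2-pigeonhole fzero (fsuc fzero) fzero _ i≢l = ⊥-elim (i≢l ≡.refl)
    fin2-pigeonhole fzero (fsuc fzero) (fsuc fzero) _ _ = ≡.refl
    fin2-pigeonhole (fsuc fzero) fzero fzero _ _ = ≡.refl
    fin2-pigeonhole (fsuc fzero) fzero (fsuc fzero) _ i≢l = ⊥-elim (i≢l ≡.refl)
    fin2-pigeonhole (fsuc fzero) (fsuc fzero) _ i≢j _ = ⊥-elim (i≢j ≡.refl)

    pigeonhole : ∀ a b l → ¬ a ≡Q b → ¬ a ≡Q l → b ≡Q l
    pigeonhole a b l a≢b a≢l = sameClass⇒≡Q (fin2-pigeonhole (classOf a) (classOf b) (classOf l)
      (λ eq → a≢b (sameClass⇒≡Q eq)) (λ eq → a≢l (sameClass⇒≡Q eq)))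

    ~⇒≢Q : ∀ {x y} → x ~ y → ¬ x ≡Q y
    ~⇒≢Q x~y x≡y = Cong⇒¬Adj Q 1∉Q x≡y (IsUnitMod-mono QM⊆Q x~y)

    ~⇒≢M : ∀ {x y} → x ~ y → ¬ x ≡M y
    ~⇒≢M x~y x≡y = Cong⇒¬Adj M 1∉M x≡y (IsUnitMod-mono QM⊆M x~y)

  -- Two distinct edges of G_{R/QM} with the same endpoints mod M are not joined by
  -- an edge: mod Q each edge joins the two classes, so x ≡ u forces y ≡ v (and then
  -- the edges agree mod QM), while x ≢ u forces x ≡ v and y ≡ u.
  edges-over-same-edge-far : ∀ {x y u v} → x ≡M u → y ≡M v → x ~ y → u ~ v → ¬ SameEdge R QM x y u v →
                             ¬ (x ~ u ⊎ x ~ v ⊎ y ~ u ⊎ y ~ v)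
  edges-over-same-edge-far {x} {y} {u} {v} x≡u y≡v x~y u~v different with excludedMiddle {x ≡Q u}
  ... | yes x≡Qu = λ _ → different (inj₁ (Q∩M⊆QM _ x≡Qu x≡u , Q∩M⊆QM _ y≡Qv y≡v))
    where
    y≡Qv : y ≡Q v
    y≡Qv = pigeonhole x y v (~⇒≢Q x~y) λ x≡Qv → ~⇒≢Q u~v (Cong-trans Q (Cong-sym Q x≡Qu) x≡Qv)
  ... | no x≢Qu = λ
    { (inj₁ x~u) → ~⇒≢M x~u x≡u
    ; (inj₂ (inj₁ x~v)) → ~⇒≢Q x~v x≡Qv
    ; (inj₂ (inj₂ (inj₁ y~u))) → ~⇒≢Q y~u y≡Qu
    ; (inj₂ (inj₂ (inj₂ y~v))) → ~⇒≢M y~v y≡v }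
    where
    y≡Qu : y ≡Q u
    y≡Qu = pigeonhole x y u (~⇒≢Q x~y) x≢Qu
    x≡Qv : x ≡Q v
    x≡Qv = pigeonhole y x v (λ y≡Qx → ~⇒≢Q x~y (Cong-sym Q y≡Qx)) λ y≡Qv → ~⇒≢Q u~v (Cong-trans Q (Cong-sym Q y≡Qu) y≡Qv)

  open UnitEnumeration R excludedMiddle using (unitCount)

  φ : ℕ
  φ = proj₁ (unitCount M |R/M|≡2+m₂)

  open UnitaryCayleyGraph R excludedMiddle M 1∉M (suc (suc m₂)) |R/M|≡2+m₂ φ (proj₂ (unitCount M |R/M|≡2+m₂))
    using (orbits; 2*orbits≡n*φ; edgeColour; edgeColour-cong; edgeColour-sym; edgeColour-injective)

  strongEdgeColoring : StrongEdgeColoring R QM orbits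
  strongEdgeColoring = edgeColour , (λ x x′ y y′ x≡x′ y≡y′ → edgeColour-cong x x′ y y′ (QM⊆M _ x≡x′) (QM⊆M _ y≡y′)) ,
    edgeColour-sym , strong
    where
    strong : ∀ x y u v → x ~ y → u ~ v → ¬ SameEdge R QM x y u v → (x ~ u ⊎ x ~ v ⊎ y ~ u ⊎ y ~ v) →
             edgeColour x y ≢ edgeColour u v
    strong x y u v x~y u~v different close eq
      with edgeColour-injective x y u v (IsUnitMod-mono QM⊆M x~y) (IsUnitMod-mono QM⊆M u~v) eq
    ... | inj₁ (x≡u , y≡v) = edges-over-same-edge-far x≡u y≡v x~y u~v different close
    ... | inj₂ (x≡v , y≡u) = edges-over-same-edge-far x≡v y≡u x~y (Adj-sym (Q ·ᴵ mem M) u~v)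
            (λ { (inj₁ same) → different (inj₂ same) ; (inj₂ same) → different (inj₁ same) })
            (swap close)
      where
      swap : x ~ u ⊎ x ~ v ⊎ y ~ u ⊎ y ~ v → x ~ v ⊎ x ~ u ⊎ y ~ v ⊎ y ~ u
      swap (inj₁ x~u) = inj₂ (inj₁ x~u)
      swap (inj₂ (inj₁ x~v)) = inj₁ x~v
      swap (inj₂ (inj₂ (inj₁ y~u))) = inj₂ (inj₂ (inj₂ y~u))
      swap (inj₂ (inj₂ (inj₂ y~v))) = inj₂ (inj₂ (inj₁ y~v))

  s′[R/QM]≤ : Σ ℕ λ φ → Σ ℕ λ s → UnitCount R (mem M) φ × IsStrongChromaticIndex R QM s × 2 ℕ.* s ≤ suc (suc m₂) ℕ.* φ
  s′[R/QM]≤ = φ , bound (Counting.least (λ _ → excludedMiddle) orbits strongEdgeColoring)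
    where
    bound : (Σ ℕ λ s → StrongEdgeColoring R QM s × (∀ t → StrongEdgeColoring R QM t → s ≤ t)) →
            Σ ℕ λ s → UnitCount R (mem M) φ × IsStrongChromaticIndex R QM s × 2 ℕ.* s ≤ suc (suc m₂) ℕ.* φ
    bound (s , coloring , minimal) = s , proj₂ (unitCount M |R/M|≡2+m₂) , (coloring , minimal) ,
      ℕ.≤-trans (ℕ.*-monoʳ-≤ 2 (minimal orbits strongEdgeColoring)) (ℕ.≤-reflexive 2*orbits≡n*φ)

open import Data.Nat using (_*_)
open import Relation.Binary.PropositionalEquality using (_≡_)
open import Data.Nat.Tactic.RingSolver using (solve-∀)

pᵅ*φ≡ : ∀ p₁ k → suc p₁ ^ suc k * (p₁ * suc p₁ ^ k) ≡ suc p₁ ^ (2 * suc k ∸ 1) * (suc p₁ ∸ 1)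
pᵅ*φ≡ p₁ k = ≡.sym (≡.trans
  (≡.cong (_* p₁) (≡.trans (ℕ.^-distribˡ-+-* (suc p₁) k (suc k ℕ.+ 0))
                           (≡.cong (λ e → suc p₁ ^ k * suc p₁ ^ e) (ℕ.+-identityʳ (suc k)))))
  (rearrange (suc p₁) p₁ (suc p₁ ^ k)))
  where
  rearrange : ∀ p q X → (X * (p * X)) * q ≡ (p * X) * (q * X)
  rearrange = solve-∀

theorem5p2 : {c ℓ : Level} (R : CommutativeRing c ℓ) → IsDedekindDomain R →
    (P Q M : Ideal R) →
    NonZeroIdeal R P → NonZeroIdeal R Q → NonZeroIdeal R M →
    IsPrimeIdeal R P → IsPrimeIdeal R Q →
    ¬ (_⊆_ R M Q) →
    (p : ℕ) → QuotCard R (mem P) p → 2 ≤ p →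
    (m : ℕ) → QuotCard R (mem M) m → 2 ≤ m →
    QuotCard R (mem Q) 2 →
    (α : ℕ) → 1 ≤ α →
    (Σ ℕ λ n → Σ ℕ λ φ → Σ ℕ λ s →
       QuotCard R (_^ₚ_ R (mem P) α) n ×
       UnitCount R (_^ₚ_ R (mem P) α) φ ×
       IsStrongChromaticIndex R (_^ₚ_ R (mem P) α) s ×
       2 * s ≡ n * φ ×
       2 * s ≡ p ^ (2 * α ∸ 1) * (p ∸ 1))
    ×
    (Σ ℕ λ φ → Σ ℕ λ s →
       UnitCount R (mem M) φ ×
       IsStrongChromaticIndex R (_·ₚ_ R (mem Q) (mem M)) s ×
       2 * s ≤ m * φ)
theorem5p2 R R-dedekind P Q M P≢0 Q≢0 _ P-prime Q-prime M⊈Q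
           p |R/P|≡p (s≤s {n = p₁} _) m |R/M|≡m (s≤s (s≤s {n = m₂} _)) |R/Q|≡2 α (s≤s {n = k} _) =
  (suc p₁ ^ suc k , p₁ * suc p₁ ^ k , orbits ,
   |R/Pᵅ|≡pᵅ , φ[R/Pᵅ]≡p₁pᵏ , s′[R/Pᵅ]≡orbits , 2*orbits≡n*φ , ≡.trans 2*orbits≡n*φ (pᵅ*φ≡ p₁ k)) ,
  s′[R/QM]≤
  where
  open PrimePowerGraph R R-dedekind P P≢0 P-prime |R/P|≡p k
  open ProductGraph R Q M (IsDedekindDomain.dimLe1 R-dedekind Q Q-prime Q≢0) M⊈Q |R/M|≡m |R/Q|≡2
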